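{- The function $f$ has no finite-fold Diophantine representation; that is, there is no polynomial $W(x_1,x_2,x_3,\ldots,x_m)$ with integer coefficients such that for all non-negative integers $x_1,x_2$ one has $x_2=f(x_1)$ (with $x_1\geq 1$) if and only if there exist $x_3,\ldots,x_m\in\mathbb{N}$ with $W(x_1,x_2,x_3,\ldots,x_m)=0$, and such that for all $x_1,x_2\in\mathbb{N}$ the equation $W(x_1,x_2,x_3,\ldots,x_m)=0$ has only finitely many solutions $(x_3,\ldots,x_m)\in\mathbb{N}^{m-2}$.
   Context: $\mathbb{N}=\{0,1,2,\ldots\}$. For a positive integer $n$, let $E_n=\{x_i=1,\ x_i+x_j=x_k,\ x_i\cdot x_j=x_k : i,j,k\in\{1,\ldots,n\}\}$. Let $f(n)$ denote the smallest non-negative integer $b$ such that for each system $S\subseteq E_n$ with a finite number of solutions in integers $x_1,\ldots,x_n$, all these solutions belong to $[-b,b]^n$. A Diophantine representation of a set $\mathcal{M}\subseteq\mathbb{N}^k$ is a polynomial $W(a_1,\ldots,a_k,x_1,\ldots,x_m)$ with integer coefficients such that $(a_1,\ldots,a_k)\in\mathcal{M}$ iff $\exists x_1,\ldots,x_m\in\mathbb{N}\ W(a_1,\ldots,a_k,x_1,\ldots,x_m)=0$; it is finite-fold if for every $(a_1,\ldots,a_k)\in\mathbb{N}^k$ the equation has only finitely many solutions $(x_1,\ldots,x_m)\in\mathbb{N}^m$. A Diophantine representation of a function is one of its graph. -}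

module Defs where

open import Data.Nat using (ℕ; suc; _<_; _≤_)
open import Data.Integer as ℤ using (ℤ; +_; ∣_∣)
open import Data.Fin using (Fin)
open import Data.Vec using (Vec; lookup; _∷_)
open import Data.List using (List)
open import Data.List.Relation.Unary.All using (All)
open import Data.Vec.Relation.Unary.All renaming (All to VAll) using ()
open import Data.List.Membership.Propositional using (_∈_)
open import Data.Product using (Σ; ∃; _×_)
open import Relation.Binary.PropositionalEquality using (_≡_)
open import Relation.Nullary using (¬_)

-- The equations of E_n, over variables x_1..x_n (indexed by Fin n)

data Equation (n : ℕ) : Set where
  one : Fin n → Equation n
  add : Fin n → Fin n → Fin n → Equation n
  mul : Fin n → Fin n → Fin n → Equation n

Sat : ∀ {n} → Vec ℤ n → Equation n → Set
Sat x (one i)     = lookup x i ≡ ℤ.+ 1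
Sat x (add i j k) = lookup x i ℤ.+ lookup x j ≡ lookup x k
Sat x (mul i j k) = lookup x i ℤ.* lookup x j ≡ lookup x k

-- A system S ⊆ E_n is given by a (finite) list of equations of E_n.
System : ℕ → Set
System n = List (Equation n)

Solution : ∀ {n} → System n → Vec ℤ n → Set
Solution S x = All (Sat x) S

FinitelyManySolutions : ∀ {n} → System n → Set
FinitelyManySolutions {n} S = ∃ λ (L : List (Vec ℤ n)) → ∀ x → Solution S x → x ∈ L

InBox : ∀ {n} → ℕ → Vec ℤ n → Set
InBox b x = VAll (λ z → ∣ z ∣ ≤ b) x

IsBound : ℕ → ℕ → Set
IsBound n b = (S : System n) → FinitelyManySolutions S →
              ∀ x → Solution S x → InBox b x

-- Graph of f:  f(n) = v  iff  v is the smallest bound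
FGraph : ℕ → ℕ → Set
FGraph n v = IsBound n v × (∀ b → b < v → ¬ IsBound n b)

data Poly (m : ℕ) : Set where
  var   : Fin m → Poly m
  const : ℤ → Poly m
  _⊕_   : Poly m → Poly m → Poly m
  _⊗_   : Poly m → Poly m → Poly m

eval : ∀ {m} → Poly m → Vec ℕ m → ℤ
eval (var i)   x = + lookup x i
eval (const c) x = c
eval (p ⊕ q)   x = eval p x ℤ.+ eval q x
eval (p ⊗ q)   x = eval p x ℤ.* eval q x

Represents : ∀ {k} → Poly (suc (suc k)) → Set
Represents {k} W = ∀ (x₁ x₂ : ℕ) →
  ((1 ≤ x₁ × FGraph x₁ x₂) → ∃ λ (r : Vec ℕ k) → eval W (x₁ ∷ x₂ ∷ r) ≡ + 0)
  × ((∃ λ (r : Vec ℕ k) → eval W (x₁ ∷ x₂ ∷ r) ≡ + 0) → 1 ≤ x₁ × FGraph x₁ x₂)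

FiniteFold : ∀ {k} → Poly (suc (suc k)) → Set
FiniteFold {k} W = ∀ (x₁ x₂ : ℕ) → ∃ λ (L : List (Vec ℕ k)) →
  ∀ (r : Vec ℕ k) → eval W (x₁ ∷ x₂ ∷ r) ≡ + 0 → r ∈ L

-- Suppose W(x₁, x₂, x₃, …) represented f finite-fold. Take n = 2^(2^D), with D
-- depending only on W: it is computed inside the system by D squarings, and it
-- exceeds the 2D + 1 variables the construction needs. Let v = f(n) (f(n) exists
-- only classically, which suffices as the goal is a negation) and r a zero of
-- W(n, v, ·). We write down a system S ⊆ E_n whose variables hold: 1; four input
-- variables per value, whose sums of squares encode v, r₁, …, r_k; a squaring chain
-- computing n; the value W(n, v, r) of the compiled polynomial, forced to be 0; and
-- v + 1, padded by equations x = 1 up to exactly n variables. Running this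
-- straight-line program, with inputs from Lagrange's four-square theorem, gives a
-- solution containing v + 1. Conversely, in any solution the sums of squares are a
-- zero of W at (n, ·), so by representation and finite-foldness they range over a
-- finite set; this bounds every variable, so S has finitely many solutions, and by
-- definition of f(n) they all lie in [−v, v]ⁿ — contradicting the entry v + 1.

module Submission where

open import Defs
open import Data.Nat using (ℕ; suc)
open import Data.Product using (Σ; _×_)
open import Relation.Nullary using (¬_)
open import Data.Product using (_,_; proj₁)

module FourSquareTheorem where
  open import Data.Nat as ℕ using (ℕ; zero; suc; z≤n; s≤s)
  import Data.Nat.Properties as ℕₚ
  open import Data.Nat.DivMod as ℕ÷ using ()
  open import Data.Nat.Divisibility using (_∣_; divides; ∣⇒≤)
  open import Data.Nat.Primality using (Prime; prime; composite; euclidsLemma; prime⇒nonTrivial)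
  open import Data.Nat.Primality.Factorisation using (factorise)
  open import Data.Nat.ListAction using (product)
  open import Data.Nat.Induction using (<-rec)
  import Data.Nat.Tactic.RingSolver as ℕ-Solver
  open import Data.Integer using (ℤ; +_; -[1+_]; ∣_∣; _+_; _*_; _-_; -_)
  import Data.Integer.Properties as ℤₚ
  import Data.Integer.DivMod as ℤ÷
  open import Data.Integer.Tactic.RingSolver using (solve-∀)
  open import Data.Fin using (toℕ; fromℕ<)
  import Data.Fin.Properties as Finₚ
  open import Data.List using ([]; _∷_)
  open import Data.List.Relation.Unary.All using (All; []; _∷_)
  open import Data.Product using (Σ; _×_; _,_; proj₁; proj₂)
  open import Data.Sum using (inj₁; inj₂)
  open import Data.Empty using (⊥; ⊥-elim)
  open import Relation.Nullary using (¬_; Dec; yes; no)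
  open import Relation.Binary.PropositionalEquality
  open import Relation.Binary using (tri<; tri≈; tri>)
  open ≡-Reasoning

  sq₄ : ℤ → ℤ → ℤ → ℤ → ℤ
  sq₄ a b c d = a * a + b * b + c * c + d * d

  nsq₄ : ℕ → ℕ → ℕ → ℕ → ℕ
  nsq₄ a b c d = a ℕ.* a ℕ.+ b ℕ.* b ℕ.+ c ℕ.* c ℕ.+ d ℕ.* d

  record FourSquares (z : ℤ) : Set where
    constructor fourSquares
    field
      a b c d : ℤ
      eq : z ≡ sq₄ a b c d

  sq₄-cong : ∀ {a b c d a′ b′ c′ d′} → a ≡ a′ → b ≡ b′ → c ≡ c′ → d ≡ d′ →
             sq₄ a b c d ≡ sq₄ a′ b′ c′ d′
  sq₄-cong refl refl refl refl = refl

  sq₄-abs : ∀ a b c d → sq₄ a b c d ≡ + nsq₄ (∣ a ∣) (∣ b ∣) (∣ c ∣) (∣ d ∣)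
  sq₄-abs a b c d = begin
    sq₄ a b c d
      ≡⟨ cong₂ _+_ (cong₂ _+_ (cong₂ _+_ (square a) (square b)) (square c)) (square d) ⟩
    + A + + B + + C + + D
      ≡⟨ cong (λ t → t + + C + + D) (sym (ℤₚ.pos-+ A B)) ⟩
    + (A ℕ.+ B) + + C + + D
      ≡⟨ cong (_+ + D) (sym (ℤₚ.pos-+ (A ℕ.+ B) C)) ⟩
    + (A ℕ.+ B ℕ.+ C) + + D
      ≡⟨ sym (ℤₚ.pos-+ (A ℕ.+ B ℕ.+ C) D) ⟩
    + nsq₄ (∣ a ∣) (∣ b ∣) (∣ c ∣) (∣ d ∣) ∎
    where
    A B C D : ℕ
    A = ∣ a ∣ ℕ.* ∣ a ∣
    B = ∣ b ∣ ℕ.* ∣ b ∣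
    C = ∣ c ∣ ℕ.* ∣ c ∣
    D = ∣ d ∣ ℕ.* ∣ d ∣
    square : ∀ i → i * i ≡ + (∣ i ∣ ℕ.* ∣ i ∣)
    square (+ n)    = sym (ℤₚ.pos-* n n)
    square -[1+ n ] = refl

  -- Euler's four-square identity (stated unfolded for the ring solver, which does not
  -- see through sq₄).
  euler-identity : ∀ a b c d e f g h →
    sq₄ a b c d * sq₄ e f g h ≡
    sq₄ (a * e + b * f + c * g + d * h) (a * f - b * e + c * h - d * g)
        (a * g - b * h - c * e + d * f) (a * h + b * g - c * f - d * e)
  euler-identity = expanded
    where
    expanded : ∀ a b c d e f g h →
      (a * a + b * b + c * c + d * d) * (e * e + f * f + g * g + h * h) ≡
      (a * e + b * f + c * g + d * h) * (a * e + b * f + c * g + d * h) +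
      (a * f - b * e + c * h - d * g) * (a * f - b * e + c * h - d * g) +
      (a * g - b * h - c * e + d * f) * (a * g - b * h - c * e + d * f) +
      (a * h + b * g - c * f - d * e) * (a * h + b * g - c * f - d * e)
    expanded = solve-∀

  fourSquares-* : ∀ {x y} → FourSquares x → FourSquares y → FourSquares (x * y)
  fourSquares-* (fourSquares a b c d x≡) (fourSquares e f g h y≡) =
    fourSquares (a * e + b * f + c * g + d * h) (a * f - b * e + c * h - d * g)
                (a * g - b * h - c * e + d * f) (a * h + b * g - c * f - d * e)
                (trans (cong₂ _*_ x≡ y≡) (euler-identity a b c d e f g h))

  %-≡⇒∣∸ : ∀ p .{{_ : ℕ.NonZero p}} x y → x ℕ.% p ≡ y ℕ.% p → p ∣ y ℕ.∸ x
  %-≡⇒∣∸ p x y e = divides (y ℕ./ p ℕ.∸ x ℕ./ p) (begin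
    y ℕ.∸ x
      ≡⟨ cong₂ ℕ._∸_ (ℕ÷.m≡m%n+[m/n]*n y p) (ℕ÷.m≡m%n+[m/n]*n x p) ⟩
    (y ℕ.% p ℕ.+ y ℕ./ p ℕ.* p) ℕ.∸ (x ℕ.% p ℕ.+ x ℕ./ p ℕ.* p)
      ≡⟨ cong (λ t → (y ℕ.% p ℕ.+ y ℕ./ p ℕ.* p) ℕ.∸ (t ℕ.+ x ℕ./ p ℕ.* p)) e ⟩
    (y ℕ.% p ℕ.+ y ℕ./ p ℕ.* p) ℕ.∸ (y ℕ.% p ℕ.+ x ℕ./ p ℕ.* p)
      ≡⟨ ℕₚ.[m+n]∸[m+o]≡n∸o (y ℕ.% p) _ _ ⟩
    y ℕ./ p ℕ.* p ℕ.∸ x ℕ./ p ℕ.* p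
      ≡⟨ sym (ℕₚ.*-distribʳ-∸ p (y ℕ./ p) (x ℕ./ p)) ⟩
    (y ℕ./ p ℕ.∸ x ℕ./ p) ℕ.* p ∎)

  difference-of-squares : ∀ a b → a ℕ.≤ b → b ℕ.* b ℕ.∸ a ℕ.* a ≡ (b ℕ.∸ a) ℕ.* (b ℕ.+ a)
  difference-of-squares a b a≤b with b ℕ.∸ a | ℕₚ.m+[n∸m]≡n a≤b
  ... | d | refl = trans (cong (ℕ._∸ a ℕ.* a) (expand a d)) (ℕₚ.m+n∸m≡n (a ℕ.* a) _)
    where
    expand : ∀ a d → (a ℕ.+ d) ℕ.* (a ℕ.+ d) ≡ a ℕ.* a ℕ.+ d ℕ.* ((a ℕ.+ d) ℕ.+ a)
    expand = ℕ-Solver.solve-∀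

  -- For an odd prime p = 2h + 1 there are a, b ≤ h with p ∣ a² + b² + 1.
  -- The h + 1 residues a² and the h + 1 residues −1 − b² (a, b ≤ h) are p + 1
  -- values in ℤ/p, so two of them coincide (pigeonhole); two squares a² ≡ a′²
  -- with a < a′ ≤ h are impossible because p divides neither a′ − a nor a′ + a.
  module _ (h : ℕ) (p-prime : Prime (suc (h ℕ.+ h))) where
    private
      p : ℕ
      p = suc (h ℕ.+ h)

    ∤-between : ∀ {n} → 0 ℕ.< n → n ℕ.< p → ¬ p ∣ n
    ∤-between 0<n n<p p∣n = ℕₚ.<⇒≱ n<p (∣⇒≤ {{ℕ.>-nonZero 0<n}} p∣n)

    squares-distinct : ∀ a b → a ℕ.< b → b ℕ.≤ h → (a ℕ.* a) ℕ.% p ≢ (b ℕ.* b) ℕ.% p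
    squares-distinct a b a<b b≤h e
      with euclidsLemma (b ℕ.∸ a) (b ℕ.+ a) p-prime
             (subst (p ∣_) (difference-of-squares a b (ℕₚ.<⇒≤ a<b)) (%-≡⇒∣∸ p (a ℕ.* a) (b ℕ.* b) e))
    ... | inj₁ p∣b-a = ∤-between (ℕₚ.m<n⇒0<n∸m a<b)
                         (s≤s (ℕₚ.≤-trans (ℕₚ.m∸n≤m b a) (ℕₚ.≤-trans b≤h (ℕₚ.m≤m+n h h)))) p∣b-a
    ... | inj₂ p∣b+a = ∤-between (ℕₚ.<-≤-trans (ℕₚ.≤-<-trans z≤n a<b) (ℕₚ.m≤m+n b a))
                         (s≤s (ℕₚ.+-mono-≤ b≤h (ℕₚ.≤-trans (ℕₚ.<⇒≤ a<b) b≤h))) p∣b+a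

    -- The p + 1 residues: a² for n = a ≤ h and (p − 1) − b² for n = h + 1 + b.
    residue : ℕ → ℕ
    residue n with n ℕ.≤? h
    ... | yes _ = (n ℕ.* n) ℕ.% p
    ... | no  _ = (h ℕ.+ h) ℕ.∸ (((n ℕ.∸ suc h) ℕ.* (n ℕ.∸ suc h)) ℕ.% p)

    residue<p : ∀ n → residue n ℕ.< p
    residue<p n with n ℕ.≤? h
    ... | yes _ = ℕ÷.m%n<n (n ℕ.* n) p
    ... | no  _ = s≤s (ℕₚ.m∸n≤m (h ℕ.+ h) (((n ℕ.∸ suc h) ℕ.* (n ℕ.∸ suc h)) ℕ.% p))

    residue-low : ∀ n → n ℕ.≤ h → residue n ≡ (n ℕ.* n) ℕ.% p
    residue-low n n≤h with n ℕ.≤? h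
    ... | yes _ = refl
    ... | no n≰h = ⊥-elim (n≰h n≤h)

    residue-high : ∀ n → ¬ n ℕ.≤ h → residue n ≡ (h ℕ.+ h) ℕ.∸ (((n ℕ.∸ suc h) ℕ.* (n ℕ.∸ suc h)) ℕ.% p)
    residue-high n n≰h with n ℕ.≤? h
    ... | yes n≤h = ⊥-elim (n≰h n≤h)
    ... | no  _   = refl

    %-≤ : ∀ x → x ℕ.% p ℕ.≤ h ℕ.+ h
    %-≤ x = ℕₚ.<⇒≤pred (ℕ÷.m%n<n x p)

    mixed-collision : ∀ a b → (a ℕ.* a) ℕ.% p ≡ (h ℕ.+ h) ℕ.∸ ((b ℕ.* b) ℕ.% p) →
                      p ∣ a ℕ.* a ℕ.+ b ℕ.* b ℕ.+ 1
    mixed-collision a b e = divides (1 ℕ.+ (A ℕ./ p ℕ.+ B ℕ./ p)) (begin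
      A ℕ.+ B ℕ.+ 1
        ≡⟨ cong₂ (λ s t → s ℕ.+ t ℕ.+ 1) (ℕ÷.m≡m%n+[m/n]*n A p) (ℕ÷.m≡m%n+[m/n]*n B p) ⟩
      (A ℕ.% p ℕ.+ A ℕ./ p ℕ.* p) ℕ.+ (B ℕ.% p ℕ.+ B ℕ./ p ℕ.* p) ℕ.+ 1
        ≡⟨ regroup (A ℕ.% p) (A ℕ./ p) (B ℕ.% p) (B ℕ./ p) p ⟩
      (A ℕ.% p ℕ.+ B ℕ.% p ℕ.+ 1) ℕ.+ (A ℕ./ p ℕ.+ B ℕ./ p) ℕ.* p
        ≡⟨ cong (ℕ._+ (A ℕ./ p ℕ.+ B ℕ./ p) ℕ.* p) residues-sum ⟩
      (1 ℕ.+ (A ℕ./ p ℕ.+ B ℕ./ p)) ℕ.* p ∎)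
      where
      A B : ℕ
      A = a ℕ.* a
      B = b ℕ.* b
      residues-sum : A ℕ.% p ℕ.+ B ℕ.% p ℕ.+ 1 ≡ p
      residues-sum = begin
        A ℕ.% p ℕ.+ B ℕ.% p ℕ.+ 1           ≡⟨ cong (λ t → t ℕ.+ B ℕ.% p ℕ.+ 1) e ⟩
        (h ℕ.+ h) ℕ.∸ B ℕ.% p ℕ.+ B ℕ.% p ℕ.+ 1 ≡⟨ cong (ℕ._+ 1) (ℕₚ.m∸n+n≡m (%-≤ B)) ⟩
        h ℕ.+ h ℕ.+ 1                     ≡⟨ ℕₚ.+-comm (h ℕ.+ h) 1 ⟩
        p ∎
      regroup : ∀ ra qa rb qb p → (ra ℕ.+ qa ℕ.* p) ℕ.+ (rb ℕ.+ qb ℕ.* p) ℕ.+ 1 ≡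
                                  (ra ℕ.+ rb ℕ.+ 1) ℕ.+ (qa ℕ.+ qb) ℕ.* p
      regroup = ℕ-Solver.solve-∀

    two-squares-plus-one : Σ ℕ λ a → Σ ℕ λ b → a ℕ.≤ h × b ℕ.≤ h × p ∣ a ℕ.* a ℕ.+ b ℕ.* b ℕ.+ 1
    two-squares-plus-one with Finₚ.pigeonhole (ℕₚ.n<1+n p) (λ i → fromℕ< (residue<p (toℕ i)))
    ... | i , j , i<j , same =
      collide (toℕ i) (toℕ j) i<j (Finₚ.toℕ<n j) same-residue (toℕ i ℕ.≤? h) (toℕ j ℕ.≤? h)
      where
      same-residue : residue (toℕ i) ≡ residue (toℕ j)
      same-residue = trans (sym (Finₚ.toℕ-fromℕ< (residue<p (toℕ i))))
                           (trans (cong toℕ same) (Finₚ.toℕ-fromℕ< (residue<p (toℕ j))))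
      shift-≤ : ∀ b → b ℕ.< suc p → b ℕ.∸ suc h ℕ.≤ h
      shift-≤ b b<1+p = ℕₚ.m≤n+o⇒m∸n≤o b (suc h) (ℕₚ.<⇒≤pred b<1+p)
      collide : ∀ a b → a ℕ.< b → b ℕ.< suc p → residue a ≡ residue b → Dec (a ℕ.≤ h) → Dec (b ℕ.≤ h) →
                Σ ℕ λ a → Σ ℕ λ b → a ℕ.≤ h × b ℕ.≤ h × p ∣ a ℕ.* a ℕ.+ b ℕ.* b ℕ.+ 1
      collide a b a<b b<1+p e (yes a≤h) (yes b≤h) =
        ⊥-elim (squares-distinct a b a<b b≤h (trans (sym (residue-low a a≤h)) (trans e (residue-low b b≤h))))
      collide a b a<b b<1+p e (no a≰h) (yes b≤h) = ⊥-elim (a≰h (ℕₚ.≤-trans (ℕₚ.<⇒≤ a<b) b≤h))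
      collide a b a<b b<1+p e (no a≰h) (no b≰h) =
        ⊥-elim (squares-distinct (a ℕ.∸ suc h) (b ℕ.∸ suc h) (ℕₚ.∸-monoˡ-< a<b (ℕₚ.≰⇒> a≰h)) (shift-≤ b b<1+p)
                 (ℕₚ.∸-cancelˡ-≡ (%-≤ ((a ℕ.∸ suc h) ℕ.* (a ℕ.∸ suc h))) (%-≤ ((b ℕ.∸ suc h) ℕ.* (b ℕ.∸ suc h)))
                                 (trans (sym (residue-high a a≰h)) (trans e (residue-high b b≰h)))))
      collide a b a<b b<1+p e (yes a≤h) (no b≰h) =
        a , b ℕ.∸ suc h , a≤h , shift-≤ b b<1+p ,
        mixed-collision a (b ℕ.∸ suc h) (trans (sym (residue-low a a≤h)) (trans e (residue-high b b≰h)))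

  centred-residue : (x : ℤ) (m : ℕ) .{{_ : ℕ.NonZero m}} → Σ ℤ λ q → 2 ℕ.* ∣ x - q * + m ∣ ℕ.≤ m
  centred-residue x m with 2 ℕ.* (x ℤ÷.%ℕ m) ℕ.≤? m
  ... | yes 2ρ≤m = Q , subst (λ t → 2 ℕ.* ∣ t ∣ ℕ.≤ m) (sym round-down) 2ρ≤m
    where
    Q : ℤ
    Q = x ℤ÷./ℕ m
    round-down : x - Q * + m ≡ + (x ℤ÷.%ℕ m)
    round-down = begin
      x - Q * + m                              ≡⟨ cong (_- Q * + m) (ℤ÷.a≡a%ℕn+[a/ℕn]*n x m) ⟩
      + (x ℤ÷.%ℕ m) + Q * + m - Q * + m        ≡⟨ cancel (+ (x ℤ÷.%ℕ m)) (Q * + m) ⟩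
      + (x ℤ÷.%ℕ m) ∎
      where
      cancel : ∀ a b → a + b - b ≡ a
      cancel = solve-∀
  ... | no 2ρ≰m = Q + + 1 , subst (λ t → 2 ℕ.* ∣ t ∣ ℕ.≤ m) (sym round-up) bound
    where
    Q : ℤ
    Q = x ℤ÷./ℕ m
    ρ : ℕ
    ρ = x ℤ÷.%ℕ m
    round-up : x - (Q + + 1) * + m ≡ - + (m ℕ.∸ ρ)
    round-up = begin
      x - (Q + + 1) * + m                 ≡⟨ cong (_- (Q + + 1) * + m) (ℤ÷.a≡a%ℕn+[a/ℕn]*n x m) ⟩
      + ρ + Q * + m - (Q + + 1) * + m     ≡⟨ cancel (+ ρ) Q (+ m) ⟩
      + ρ - + m                           ≡⟨ cong (λ t → + ρ - t) m≡[m-ρ]+ρ ⟩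
      + ρ - (+ (m ℕ.∸ ρ) + + ρ)           ≡⟨ cancel′ (+ ρ) (+ (m ℕ.∸ ρ)) ⟩
      - + (m ℕ.∸ ρ) ∎
      where
      m≡[m-ρ]+ρ : + m ≡ + (m ℕ.∸ ρ) + + ρ
      m≡[m-ρ]+ρ = trans (cong +_ (sym (ℕₚ.m∸n+n≡m (ℕₚ.<⇒≤ (ℤ÷.n%ℕd<d x m))))) (ℤₚ.pos-+ (m ℕ.∸ ρ) ρ)
      cancel : ∀ a b c → a + b * c - (b + + 1) * c ≡ a - c
      cancel = solve-∀
      cancel′ : ∀ a b → a - (b + a) ≡ - b
      cancel′ = solve-∀
    -- 2(m − ρ) ≤ m because m < 2ρ
    bound : 2 ℕ.* ∣ - + (m ℕ.∸ ρ) ∣ ℕ.≤ m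
    bound rewrite ℤₚ.∣-i∣≡∣i∣ (+ (m ℕ.∸ ρ)) | ℕₚ.*-distribˡ-∸ 2 m ρ =
      ℕₚ.m≤n+o⇒m∸n≤o (2 ℕ.* m) (2 ℕ.* ρ)
        (subst (ℕ._≤ 2 ℕ.* ρ ℕ.+ m) (cong (m ℕ.+_) (sym (ℕₚ.+-identityʳ m)))
               (ℕₚ.+-monoˡ-≤ m (ℕₚ.<⇒≤ (ℕₚ.≰⇒> 2ρ≰m))))

  split : ∀ x q M → + 2 * x ≡ + 2 * (x - q * M) + M * (+ 2 * q)
  split = solve-∀

  half-residue : ∀ x q m → 2 ℕ.* ∣ x - q * + m ∣ ≡ m → Σ ℤ λ s → + 2 * x ≡ + m * (+ 2 * s + + 1)
  half-residue x q m e with x - q * + m in y≡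
  ... | + u = q , (begin
    + 2 * x                                ≡⟨ split x q (+ m) ⟩
    + 2 * (x - q * + m) + + m * (+ 2 * q)  ≡⟨ cong (λ t → + 2 * t + + m * (+ 2 * q)) y≡ ⟩
    + 2 * + u + + m * (+ 2 * q)            ≡⟨ cong (_+ + m * (+ 2 * q)) (trans (sym (ℤₚ.pos-* 2 u)) (cong +_ e)) ⟩
    + m + + m * (+ 2 * q)                  ≡⟨ collect (+ m) q ⟩
    + m * (+ 2 * q + + 1) ∎)
    where
    collect : ∀ M q → M + M * (+ 2 * q) ≡ M * (+ 2 * q + + 1)
    collect = solve-∀
  ... | -[1+ u ] = q - + 1 , (begin
    + 2 * x                                ≡⟨ split x q (+ m) ⟩
    + 2 * (x - q * + m) + + m * (+ 2 * q)  ≡⟨ cong (λ t → + 2 * t + + m * (+ 2 * q)) y≡ ⟩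
    + 2 * -[1+ u ] + + m * (+ 2 * q)       ≡⟨ cong (λ t → - + t + + m * (+ 2 * q)) e ⟩
    - + m + + m * (+ 2 * q)                ≡⟨ collect (+ m) q ⟩
    + m * (+ 2 * (q - + 1) + + 1) ∎)
    where
    collect : ∀ M q → - M + M * (+ 2 * q) ≡ M * (+ 2 * (q - + 1) + + 1)
    collect = solve-∀

  +-≤-≡ : ∀ {a b c d} → a ℕ.≤ c → b ℕ.≤ d → a ℕ.+ b ≡ c ℕ.+ d → a ≡ c × b ≡ d
  +-≤-≡ {a} {b} {_} {d} a≤c b≤d e with ℕₚ.m≤n⇒m<n∨m≡n a≤c
  ... | inj₁ a<c = ⊥-elim (ℕₚ.<-irrefl e (ℕₚ.+-mono-<-≤ a<c b≤d))
  ... | inj₂ refl = refl , ℕₚ.+-cancelˡ-≡ a b d e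

  nsq₄-double : ∀ u₁ u₂ u₃ u₄ → 4 ℕ.* nsq₄ u₁ u₂ u₃ u₄ ≡ nsq₄ (2 ℕ.* u₁) (2 ℕ.* u₂) (2 ℕ.* u₃) (2 ℕ.* u₄)
  nsq₄-double = expanded
    where
    expanded : ∀ a b c d → 4 ℕ.* (a ℕ.* a ℕ.+ b ℕ.* b ℕ.+ c ℕ.* c ℕ.+ d ℕ.* d) ≡
      (2 ℕ.* a) ℕ.* (2 ℕ.* a) ℕ.+ (2 ℕ.* b) ℕ.* (2 ℕ.* b) ℕ.+ (2 ℕ.* c) ℕ.* (2 ℕ.* c) ℕ.+ (2 ℕ.* d) ℕ.* (2 ℕ.* d)
    expanded = ℕ-Solver.solve-∀

  module CentredRemainders {m r u₁ u₂ u₃ u₄ : ℕ} .{{_ : ℕ.NonZero m}}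
           (c₁ : 2 ℕ.* u₁ ℕ.≤ m) (c₂ : 2 ℕ.* u₂ ℕ.≤ m) (c₃ : 2 ℕ.* u₃ ℕ.≤ m) (c₄ : 2 ℕ.* u₄ ℕ.≤ m)
           (m*r≡ : m ℕ.* r ≡ nsq₄ u₁ u₂ u₃ u₄) where
    private
      M² : ℕ
      M² = m ℕ.* m
      square-≤ : ∀ {v} → v ℕ.≤ m → v ℕ.* v ℕ.≤ M²
      square-≤ v≤m = ℕₚ.*-mono-≤ v≤m v≤m
      four-m-r : m ℕ.* (4 ℕ.* r) ≡ nsq₄ (2 ℕ.* u₁) (2 ℕ.* u₂) (2 ℕ.* u₃) (2 ℕ.* u₄)
      four-m-r = trans (reorder m r) (trans (cong (4 ℕ.*_) m*r≡) (nsq₄-double u₁ u₂ u₃ u₄))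
        where
        reorder : ∀ m r → m ℕ.* (4 ℕ.* r) ≡ 4 ℕ.* (m ℕ.* r)
        reorder = ℕ-Solver.solve-∀
      four-M² : ∀ m → m ℕ.* (4 ℕ.* m) ≡ m ℕ.* m ℕ.+ m ℕ.* m ℕ.+ m ℕ.* m ℕ.+ m ℕ.* m
      four-M² = ℕ-Solver.solve-∀

    quotient-≤ : r ℕ.≤ m
    quotient-≤ = ℕₚ.*-cancelˡ-≤ 4 (ℕₚ.*-cancelˡ-≤ m (subst₂ ℕ._≤_ (sym four-m-r) (sym (four-M² m))
      (ℕₚ.+-mono-≤ (ℕₚ.+-mono-≤ (ℕₚ.+-mono-≤ (square-≤ c₁) (square-≤ c₂)) (square-≤ c₃)) (square-≤ c₄))))

    quotient-full : r ≡ m → 2 ℕ.* u₁ ≡ m × 2 ℕ.* u₂ ≡ m × 2 ℕ.* u₃ ≡ m × 2 ℕ.* u₄ ≡ m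
    quotient-full r≡m = root (proj₁ split₂) , root (proj₂ split₂) , root (proj₂ split₃) , root (proj₂ split₄)
      where
      sum≡ : nsq₄ (2 ℕ.* u₁) (2 ℕ.* u₂) (2 ℕ.* u₃) (2 ℕ.* u₄) ≡ M² ℕ.+ M² ℕ.+ M² ℕ.+ M²
      sum≡ = trans (sym four-m-r) (trans (cong (λ t → m ℕ.* (4 ℕ.* t)) r≡m) (four-M² m))
      split₄ : (2 ℕ.* u₁) ℕ.* (2 ℕ.* u₁) ℕ.+ (2 ℕ.* u₂) ℕ.* (2 ℕ.* u₂) ℕ.+ (2 ℕ.* u₃) ℕ.* (2 ℕ.* u₃) ≡ M² ℕ.+ M² ℕ.+ M²
               × (2 ℕ.* u₄) ℕ.* (2 ℕ.* u₄) ≡ M²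
      split₄ = +-≤-≡ (ℕₚ.+-mono-≤ (ℕₚ.+-mono-≤ (square-≤ c₁) (square-≤ c₂)) (square-≤ c₃)) (square-≤ c₄) sum≡
      split₃ : (2 ℕ.* u₁) ℕ.* (2 ℕ.* u₁) ℕ.+ (2 ℕ.* u₂) ℕ.* (2 ℕ.* u₂) ≡ M² ℕ.+ M² × (2 ℕ.* u₃) ℕ.* (2 ℕ.* u₃) ≡ M²
      split₃ = +-≤-≡ (ℕₚ.+-mono-≤ (square-≤ c₁) (square-≤ c₂)) (square-≤ c₃) (proj₁ split₄)
      split₂ : (2 ℕ.* u₁) ℕ.* (2 ℕ.* u₁) ≡ M² × (2 ℕ.* u₂) ℕ.* (2 ℕ.* u₂) ≡ M²
      split₂ = +-≤-≡ (square-≤ c₁) (square-≤ c₂) (proj₁ split₃)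
      root : ∀ {v} → v ℕ.* v ≡ M² → v ≡ m
      root {v} e with ℕₚ.<-cmp v m
      ... | tri≈ _ v≡m _ = v≡m
      ... | tri< v<m _ _ = ⊥-elim (ℕₚ.<-irrefl e (ℕₚ.*-mono-< v<m v<m))
      ... | tri> _ _ v>m = ⊥-elim (ℕₚ.<-irrefl (sym e) (ℕₚ.*-mono-< v>m v>m))

    quotient-zero : r ≡ 0 → u₁ ≡ 0 × u₂ ≡ 0 × u₃ ≡ 0 × u₄ ≡ 0
    quotient-zero r≡0 = root (ℕₚ.m+n≡0⇒m≡0 A sum₂≡0) , root (ℕₚ.m+n≡0⇒n≡0 A sum₂≡0) ,
                        root (ℕₚ.m+n≡0⇒n≡0 (A ℕ.+ B) sum₃≡0) , root (ℕₚ.m+n≡0⇒n≡0 (A ℕ.+ B ℕ.+ C) sum≡0)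
      where
      A B C : ℕ
      A = u₁ ℕ.* u₁
      B = u₂ ℕ.* u₂
      C = u₃ ℕ.* u₃
      sum≡0 : nsq₄ u₁ u₂ u₃ u₄ ≡ 0
      sum≡0 = trans (sym m*r≡) (trans (cong (m ℕ.*_) r≡0) (ℕₚ.*-zeroʳ m))
      sum₃≡0 : A ℕ.+ B ℕ.+ C ≡ 0
      sum₃≡0 = ℕₚ.m+n≡0⇒m≡0 (A ℕ.+ B ℕ.+ C) sum≡0
      sum₂≡0 : A ℕ.+ B ≡ 0
      sum₂≡0 = ℕₚ.m+n≡0⇒m≡0 (A ℕ.+ B) sum₃≡0
      root : ∀ {v} → v ℕ.* v ≡ 0 → v ≡ 0
      root {v} e with ℕₚ.m*n≡0⇒m≡0∨n≡0 v e
      ... | inj₁ v≡0 = v≡0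
      ... | inj₂ v≡0 = v≡0

  reduction-identity : ∀ M P x₁ x₂ x₃ x₄ q₁ q₂ q₃ q₄ → M * P ≡ sq₄ x₁ x₂ x₃ x₄ →
    M * (P - + 2 * (x₁ * q₁ + x₂ * q₂ + x₃ * q₃ + x₄ * q₄) + M * sq₄ q₁ q₂ q₃ q₄)
      ≡ sq₄ (x₁ - q₁ * M) (x₂ - q₂ * M) (x₃ - q₃ * M) (x₄ - q₄ * M)
  reduction-identity M P x₁ x₂ x₃ x₄ q₁ q₂ q₃ q₄ H = begin
    M * (P - + 2 * Σxq + M * Q)  ≡⟨ expand M P x₁ x₂ x₃ x₄ q₁ q₂ q₃ q₄ ⟩
    M * P + (Y - X)              ≡⟨ cong (_+ (Y - X)) H ⟩
    X + (Y - X)                  ≡⟨ cancel X Y ⟩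
    Y ∎
    where
    Σxq Q X Y : ℤ
    Σxq = x₁ * q₁ + x₂ * q₂ + x₃ * q₃ + x₄ * q₄
    Q = sq₄ q₁ q₂ q₃ q₄
    X = sq₄ x₁ x₂ x₃ x₄
    Y = sq₄ (x₁ - q₁ * M) (x₂ - q₂ * M) (x₃ - q₃ * M) (x₄ - q₄ * M)
    cancel : ∀ X Y → X + (Y - X) ≡ Y
    cancel = solve-∀
    expand : ∀ M P x₁ x₂ x₃ x₄ q₁ q₂ q₃ q₄ →
      M * (P - + 2 * (x₁ * q₁ + x₂ * q₂ + x₃ * q₃ + x₄ * q₄) + M * (q₁ * q₁ + q₂ * q₂ + q₃ * q₃ + q₄ * q₄)) ≡
      M * P + (((x₁ - q₁ * M) * (x₁ - q₁ * M) + (x₂ - q₂ * M) * (x₂ - q₂ * M) + (x₃ - q₃ * M) * (x₃ - q₃ * M)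
                + (x₄ - q₄ * M) * (x₄ - q₄ * M)) - (x₁ * x₁ + x₂ * x₂ + x₃ * x₃ + x₄ * x₄))
    expand = solve-∀

  -- The four Euler products of x and y = x − qM (in the order of euler-identity)
  -- are multiples of M; for the first one this uses M·P = Σxᵢ².
  euler-product₁ : ∀ M P x₁ x₂ x₃ x₄ q₁ q₂ q₃ q₄ → M * P ≡ sq₄ x₁ x₂ x₃ x₄ →
    x₁ * (x₁ - q₁ * M) + x₂ * (x₂ - q₂ * M) + x₃ * (x₃ - q₃ * M) + x₄ * (x₄ - q₄ * M) ≡
    M * (P - (x₁ * q₁ + x₂ * q₂ + x₃ * q₃ + x₄ * q₄))
  euler-product₁ M P x₁ x₂ x₃ x₄ q₁ q₂ q₃ q₄ H = begin
    x₁ * (x₁ - q₁ * M) + x₂ * (x₂ - q₂ * M) + x₃ * (x₃ - q₃ * M) + x₄ * (x₄ - q₄ * M)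
                                ≡⟨ expand M x₁ x₂ x₃ x₄ q₁ q₂ q₃ q₄ ⟩
    sq₄ x₁ x₂ x₃ x₄ - M * Σxq   ≡⟨ cong (_- M * Σxq) (sym H) ⟩
    M * P - M * Σxq             ≡⟨ factor M P Σxq ⟩
    M * (P - Σxq) ∎
    where
    Σxq : ℤ
    Σxq = x₁ * q₁ + x₂ * q₂ + x₃ * q₃ + x₄ * q₄
    expand : ∀ M x₁ x₂ x₃ x₄ q₁ q₂ q₃ q₄ →
      x₁ * (x₁ - q₁ * M) + x₂ * (x₂ - q₂ * M) + x₃ * (x₃ - q₃ * M) + x₄ * (x₄ - q₄ * M) ≡
      (x₁ * x₁ + x₂ * x₂ + x₃ * x₃ + x₄ * x₄) - M * (x₁ * q₁ + x₂ * q₂ + x₃ * q₃ + x₄ * q₄)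
    expand = solve-∀
    factor : ∀ M P S → M * P - M * S ≡ M * (P - S)
    factor = solve-∀

  euler-product₂ : ∀ M x₁ x₂ x₃ x₄ q₁ q₂ q₃ q₄ →
    x₁ * (x₂ - q₂ * M) - x₂ * (x₁ - q₁ * M) + x₃ * (x₄ - q₄ * M) - x₄ * (x₃ - q₃ * M) ≡
    M * (x₂ * q₁ - x₁ * q₂ + x₄ * q₃ - x₃ * q₄)
  euler-product₂ = solve-∀

  euler-product₃ : ∀ M x₁ x₂ x₃ x₄ q₁ q₂ q₃ q₄ →
    x₁ * (x₃ - q₃ * M) - x₂ * (x₄ - q₄ * M) - x₃ * (x₁ - q₁ * M) + x₄ * (x₂ - q₂ * M) ≡
    M * (x₃ * q₁ - x₁ * q₃ + x₂ * q₄ - x₄ * q₂)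
  euler-product₃ = solve-∀

  euler-product₄ : ∀ M x₁ x₂ x₃ x₄ q₁ q₂ q₃ q₄ →
    x₁ * (x₄ - q₄ * M) + x₂ * (x₃ - q₃ * M) - x₃ * (x₂ - q₂ * M) - x₄ * (x₁ - q₁ * M) ≡
    M * (x₄ * q₁ + x₃ * q₂ - x₂ * q₃ - x₁ * q₄)
  euler-product₄ = solve-∀

  -- Euler's descent identity: if M·P = Σxᵢ² and M·R = Σ(xᵢ − qᵢM)², then R·P is a
  -- sum of four squares: divide Euler's identity for (M·P)(M·R) by M².
  descent-identity : ∀ m P R x₁ x₂ x₃ x₄ q₁ q₂ q₃ q₄ → let M = + suc m in
    M * P ≡ sq₄ x₁ x₂ x₃ x₄ →
    M * R ≡ sq₄ (x₁ - q₁ * M) (x₂ - q₂ * M) (x₃ - q₃ * M) (x₄ - q₄ * M) →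
    R * P ≡ sq₄ (P - (x₁ * q₁ + x₂ * q₂ + x₃ * q₃ + x₄ * q₄)) (x₂ * q₁ - x₁ * q₂ + x₄ * q₃ - x₃ * q₄)
                (x₃ * q₁ - x₁ * q₃ + x₂ * q₄ - x₄ * q₂) (x₄ * q₁ + x₃ * q₂ - x₂ * q₃ - x₁ * q₄)
  descent-identity m P R x₁ x₂ x₃ x₄ q₁ q₂ q₃ q₄ H Hr = ℤₚ.*-cancelˡ-≡ (M * M) (R * P) (sq₄ w₁ w₂ w₃ w₄) (begin
    M * M * (R * P)                     ≡⟨ regroup M R P ⟩
    (M * P) * (M * R)                   ≡⟨ cong₂ _*_ H Hr ⟩
    sq₄ x₁ x₂ x₃ x₄ * sq₄ y₁ y₂ y₃ y₄   ≡⟨ euler-identity x₁ x₂ x₃ x₄ y₁ y₂ y₃ y₄ ⟩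
    sq₄ (x₁ * y₁ + x₂ * y₂ + x₃ * y₃ + x₄ * y₄) (x₁ * y₂ - x₂ * y₁ + x₃ * y₄ - x₄ * y₃)
        (x₁ * y₃ - x₂ * y₄ - x₃ * y₁ + x₄ * y₂) (x₁ * y₄ + x₂ * y₃ - x₃ * y₂ - x₄ * y₁)
      ≡⟨ sq₄-cong (euler-product₁ M P x₁ x₂ x₃ x₄ q₁ q₂ q₃ q₄ H) (euler-product₂ M x₁ x₂ x₃ x₄ q₁ q₂ q₃ q₄)
                  (euler-product₃ M x₁ x₂ x₃ x₄ q₁ q₂ q₃ q₄) (euler-product₄ M x₁ x₂ x₃ x₄ q₁ q₂ q₃ q₄) ⟩
    sq₄ (M * w₁) (M * w₂) (M * w₃) (M * w₄) ≡⟨ scale M w₁ w₂ w₃ w₄ ⟩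
    M * M * sq₄ w₁ w₂ w₃ w₄ ∎)
    where
    M y₁ y₂ y₃ y₄ w₁ w₂ w₃ w₄ : ℤ
    M = + suc m
    y₁ = x₁ - q₁ * M
    y₂ = x₂ - q₂ * M
    y₃ = x₃ - q₃ * M
    y₄ = x₄ - q₄ * M
    w₁ = P - (x₁ * q₁ + x₂ * q₂ + x₃ * q₃ + x₄ * q₄)
    w₂ = x₂ * q₁ - x₁ * q₂ + x₄ * q₃ - x₃ * q₄
    w₃ = x₃ * q₁ - x₁ * q₃ + x₂ * q₄ - x₄ * q₂
    w₄ = x₄ * q₁ + x₃ * q₂ - x₂ * q₃ - x₁ * q₄
    regroup : ∀ M R P → M * M * (R * P) ≡ (M * P) * (M * R)
    regroup = solve-∀
    scale : ∀ M w₁ w₂ w₃ w₄ →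
      (M * w₁) * (M * w₁) + (M * w₂) * (M * w₂) + (M * w₃) * (M * w₃) + (M * w₄) * (M * w₄) ≡
      M * M * (w₁ * w₁ + w₂ * w₂ + w₃ * w₃ + w₄ * w₄)
    scale = solve-∀

  all-multiples : ∀ m P x₁ x₂ x₃ x₄ q₁ q₂ q₃ q₄ → let M = + suc m in
    M * P ≡ sq₄ x₁ x₂ x₃ x₄ → x₁ ≡ q₁ * M → x₂ ≡ q₂ * M → x₃ ≡ q₃ * M → x₄ ≡ q₄ * M →
    P ≡ M * sq₄ q₁ q₂ q₃ q₄
  all-multiples m P x₁ x₂ x₃ x₄ q₁ q₂ q₃ q₄ H e₁ e₂ e₃ e₄ =
    ℤₚ.*-cancelˡ-≡ M P (M * sq₄ q₁ q₂ q₃ q₄)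
      (trans H (trans (sq₄-cong e₁ e₂ e₃ e₄) (scale M q₁ q₂ q₃ q₄)))
    where
    M : ℤ
    M = + suc m
    scale : ∀ M q₁ q₂ q₃ q₄ →
      (q₁ * M) * (q₁ * M) + (q₂ * M) * (q₂ * M) + (q₃ * M) * (q₃ * M) + (q₄ * M) * (q₄ * M) ≡
      M * (M * (q₁ * q₁ + q₂ * q₂ + q₃ * q₃ + q₄ * q₄))
    scale = solve-∀

  -- If every 2xᵢ is an odd multiple M(2sᵢ + 1), then M·P = Σxᵢ² forces
  -- P = M·(Σ(sᵢ² + sᵢ) + 1), since Σ(2sᵢ + 1)² = 4(Σ(sᵢ² + sᵢ) + 1).
  all-half-multiples : ∀ m P x₁ x₂ x₃ x₄ s₁ s₂ s₃ s₄ → let M = + suc m in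
    M * P ≡ sq₄ x₁ x₂ x₃ x₄ →
    + 2 * x₁ ≡ M * (+ 2 * s₁ + + 1) → + 2 * x₂ ≡ M * (+ 2 * s₂ + + 1) →
    + 2 * x₃ ≡ M * (+ 2 * s₃ + + 1) → + 2 * x₄ ≡ M * (+ 2 * s₄ + + 1) →
    P ≡ M * (s₁ * s₁ + s₁ + s₂ * s₂ + s₂ + s₃ * s₃ + s₃ + s₄ * s₄ + s₄ + + 1)
  all-half-multiples m P x₁ x₂ x₃ x₄ s₁ s₂ s₃ s₄ H e₁ e₂ e₃ e₄ =
    ℤₚ.*-cancelˡ-≡ (+ 4 * M) P (M * K) (begin
      (+ 4 * M) * P                         ≡⟨ ℤₚ.*-assoc (+ 4) M P ⟩
      + 4 * (M * P)                         ≡⟨ cong (+ 4 *_) H ⟩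
      + 4 * sq₄ x₁ x₂ x₃ x₄                 ≡⟨ quadruple x₁ x₂ x₃ x₄ ⟩
      sq₄ (+ 2 * x₁) (+ 2 * x₂) (+ 2 * x₃) (+ 2 * x₄) ≡⟨ sq₄-cong e₁ e₂ e₃ e₄ ⟩
      sq₄ (M * (+ 2 * s₁ + + 1)) (M * (+ 2 * s₂ + + 1)) (M * (+ 2 * s₃ + + 1)) (M * (+ 2 * s₄ + + 1))
                                            ≡⟨ odd-squares M s₁ s₂ s₃ s₄ ⟩
      (+ 4 * M) * (M * K) ∎)
    where
    M K : ℤ
    M = + suc m
    K = s₁ * s₁ + s₁ + s₂ * s₂ + s₂ + s₃ * s₃ + s₃ + s₄ * s₄ + s₄ + + 1
    quadruple : ∀ x₁ x₂ x₃ x₄ → + 4 * (x₁ * x₁ + x₂ * x₂ + x₃ * x₃ + x₄ * x₄) ≡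
      (+ 2 * x₁) * (+ 2 * x₁) + (+ 2 * x₂) * (+ 2 * x₂) + (+ 2 * x₃) * (+ 2 * x₃) + (+ 2 * x₄) * (+ 2 * x₄)
    quadruple = solve-∀
    odd-squares : ∀ M s₁ s₂ s₃ s₄ →
      (M * (+ 2 * s₁ + + 1)) * (M * (+ 2 * s₁ + + 1)) + (M * (+ 2 * s₂ + + 1)) * (M * (+ 2 * s₂ + + 1)) +
      (M * (+ 2 * s₃ + + 1)) * (M * (+ 2 * s₃ + + 1)) + (M * (+ 2 * s₄ + + 1)) * (M * (+ 2 * s₄ + + 1)) ≡
      (+ 4 * M) * (M * (s₁ * s₁ + s₁ + s₂ * s₂ + s₂ + s₃ * s₃ + s₃ + s₄ * s₄ + s₄ + + 1))
    odd-squares = solve-∀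

  cofactor-nonneg : ∀ m R N → + suc m * R ≡ + N → R ≡ + ∣ R ∣
  cofactor-nonneg m (+ n)    N _  = refl
  cofactor-nonneg m -[1+ n ] N ()

  module Descent {p : ℕ} (p-prime : Prime p) where

    no-proper-factor : ∀ k K → suc (suc k) ℕ.< p → + p ≢ + suc (suc k) * K
    no-proper-factor k K m<p p≡mK = Prime.notComposite p-prime (composite m<p (divides ∣ K ∣ p≡Km))
      where
      p≡Km : p ≡ ∣ K ∣ ℕ.* suc (suc k)
      p≡Km = trans (cong ∣_∣ p≡mK) (trans (ℤₚ.abs-* (+ suc (suc k)) K) (ℕₚ.*-comm (suc (suc k)) ∣ K ∣))

    -- One descent step for m = k + 2, after choosing the centred residues qᵢ of xᵢ.
    -- The cofactor r of Σ(xᵢ − qᵢm)² = m·r satisfies r ≤ m; r = 0 and r = m both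
    -- make m a proper factor of p, so 0 < r < m and r·p is a sum of four squares.
    module Step (k : ℕ) (m<p : suc (suc k) ℕ.< p) (x₁ x₂ x₃ x₄ q₁ q₂ q₃ q₄ : ℤ)
                (H : + suc (suc k) * + p ≡ sq₄ x₁ x₂ x₃ x₄)
                (c₁ : 2 ℕ.* ∣ x₁ - q₁ * + suc (suc k) ∣ ℕ.≤ suc (suc k))
                (c₂ : 2 ℕ.* ∣ x₂ - q₂ * + suc (suc k) ∣ ℕ.≤ suc (suc k))
                (c₃ : 2 ℕ.* ∣ x₃ - q₃ * + suc (suc k) ∣ ℕ.≤ suc (suc k))
                (c₄ : 2 ℕ.* ∣ x₄ - q₄ * + suc (suc k) ∣ ℕ.≤ suc (suc k)) where
      m : ℕ
      m = suc (suc k)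
      M P : ℤ
      M = + m
      P = + p
      y₁ y₂ y₃ y₄ : ℤ
      y₁ = x₁ - q₁ * M
      y₂ = x₂ - q₂ * M
      y₃ = x₃ - q₃ * M
      y₄ = x₄ - q₄ * M

      R : ℤ
      R = P - + 2 * (x₁ * q₁ + x₂ * q₂ + x₃ * q₃ + x₄ * q₄) + M * sq₄ q₁ q₂ q₃ q₄

      M*R≡ : M * R ≡ sq₄ y₁ y₂ y₃ y₄
      M*R≡ = reduction-identity M P x₁ x₂ x₃ x₄ q₁ q₂ q₃ q₄ H

      r : ℕ
      r = ∣ R ∣

      R≡r : R ≡ + r
      R≡r = cofactor-nonneg (suc k) R _ (trans M*R≡ (sq₄-abs y₁ y₂ y₃ y₄))

      m*r≡ : m ℕ.* r ≡ nsq₄ (∣ y₁ ∣) (∣ y₂ ∣) (∣ y₃ ∣) (∣ y₄ ∣)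
      m*r≡ = trans (sym (ℤₚ.abs-* M R)) (cong ∣_∣ (trans M*R≡ (sq₄-abs y₁ y₂ y₃ y₄)))

      open CentredRemainders {m} {r} {∣ y₁ ∣} {∣ y₂ ∣} {∣ y₃ ∣} {∣ y₄ ∣} c₁ c₂ c₃ c₄ m*r≡

      r≤m : r ℕ.≤ m
      r≤m = quotient-≤

      r≢0 : r ≢ 0
      r≢0 r≡0 = all-zero (quotient-zero r≡0)
        where
        multiple : ∀ x q → ∣ x - q * M ∣ ≡ 0 → x ≡ q * M
        multiple x q e = ℤₚ.i-j≡0⇒i≡j x (q * M) (ℤₚ.∣i∣≡0⇒i≡0 e)
        all-zero : ∣ y₁ ∣ ≡ 0 × ∣ y₂ ∣ ≡ 0 × ∣ y₃ ∣ ≡ 0 × ∣ y₄ ∣ ≡ 0 → ⊥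
        all-zero (e₁ , e₂ , e₃ , e₄) = no-proper-factor k (sq₄ q₁ q₂ q₃ q₄) m<p
          (all-multiples (suc k) P x₁ x₂ x₃ x₄ q₁ q₂ q₃ q₄ H
            (multiple x₁ q₁ e₁) (multiple x₂ q₂ e₂) (multiple x₃ q₃ e₃) (multiple x₄ q₄ e₄))

      r≢m : r ≢ m
      r≢m r≡m = all-half (quotient-full r≡m)
        where
        HalfOdd : ℤ → Set
        HalfOdd x = Σ ℤ λ s → + 2 * x ≡ M * (+ 2 * s + + 1)
        odd-multiples : HalfOdd x₁ → HalfOdd x₂ → HalfOdd x₃ → HalfOdd x₄ → ⊥
        odd-multiples (s₁ , h₁) (s₂ , h₂) (s₃ , h₃) (s₄ , h₄) =
          no-proper-factor k _ m<p (all-half-multiples (suc k) P x₁ x₂ x₃ x₄ s₁ s₂ s₃ s₄ H h₁ h₂ h₃ h₄)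
        all-half : 2 ℕ.* ∣ y₁ ∣ ≡ m × 2 ℕ.* ∣ y₂ ∣ ≡ m × 2 ℕ.* ∣ y₃ ∣ ≡ m × 2 ℕ.* ∣ y₄ ∣ ≡ m → ⊥
        all-half (e₁ , e₂ , e₃ , e₄) = odd-multiples (half-residue x₁ q₁ m e₁) (half-residue x₂ q₂ m e₂)
                                                     (half-residue x₃ q₃ m e₃) (half-residue x₄ q₄ m e₄)

      smaller : FourSquares (+ r * P)
      smaller = fourSquares (P - (x₁ * q₁ + x₂ * q₂ + x₃ * q₃ + x₄ * q₄)) (x₂ * q₁ - x₁ * q₂ + x₄ * q₃ - x₃ * q₄)
                            (x₃ * q₁ - x₁ * q₃ + x₂ * q₄ - x₄ * q₂) (x₄ * q₁ + x₃ * q₂ - x₂ * q₃ - x₁ * q₄)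
        (trans (cong (_* P) (sym R≡r)) (descent-identity (suc k) P R x₁ x₂ x₃ x₄ q₁ q₂ q₃ q₄ H M*R≡))

    descend-once : ∀ k → suc (suc k) ℕ.< p → FourSquares (+ suc (suc k) * + p) →
                   Σ ℕ λ r → 0 ℕ.< r × r ℕ.< suc (suc k) × FourSquares (+ r * + p)
    descend-once k m<p (fourSquares x₁ x₂ x₃ x₄ H)
      with centred-residue x₁ (suc (suc k)) | centred-residue x₂ (suc (suc k))
         | centred-residue x₃ (suc (suc k)) | centred-residue x₄ (suc (suc k))
    ... | q₁ , c₁ | q₂ , c₂ | q₃ , c₃ | q₄ , c₄ =
      r , ℕₚ.n≢0⇒n>0 r≢0 , ℕₚ.≤∧≢⇒< r≤m r≢m , smaller
      where open Step k m<p x₁ x₂ x₃ x₄ q₁ q₂ q₃ q₄ H c₁ c₂ c₃ c₄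

    descent : ∀ m → 0 ℕ.< m → m ℕ.< p → FourSquares (+ m * + p) → FourSquares (+ p)
    descent = <-rec (λ m → 0 ℕ.< m → m ℕ.< p → FourSquares (+ m * + p) → FourSquares (+ p)) step
      where
      step : ∀ m → (∀ {r} → r ℕ.< m → 0 ℕ.< r → r ℕ.< p → FourSquares (+ r * + p) → FourSquares (+ p)) →
             0 ℕ.< m → m ℕ.< p → FourSquares (+ m * + p) → FourSquares (+ p)
      step 1 _ _ _ (fourSquares a b c d eq) = fourSquares a b c d (trans (sym (ℤₚ.*-identityˡ (+ p))) eq)
      step (suc (suc k)) smaller-case _ m<p sq = continue (descend-once k m<p sq)
        where
        continue : (Σ ℕ λ r → 0 ℕ.< r × r ℕ.< suc (suc k) × FourSquares (+ r * + p)) → FourSquares (+ p)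
        continue (r , 0<r , r<m , sq′) = smaller-case r<m 0<r (ℕₚ.<-trans r<m m<p) sq′

  -- An odd prime p = 2h + 1 is a sum of four squares: by two-squares-plus-one,
  -- m₀·p = a² + b² + 1² + 0² with a, b ≤ h, so 0 < m₀ < p, and descent applies.
  odd-prime : ∀ h → Prime (suc (h ℕ.+ h)) → FourSquares (+ suc (h ℕ.+ h))
  odd-prime zero (prime {{()}} _)
  odd-prime h@(suc _) p-prime with two-squares-plus-one h p-prime
  ... | a , b , a≤h , b≤h , divides m₀ a²+b²+1≡ = Descent.descent p-prime m₀ 0<m₀ m₀<p m₀p-squares
    where
    p : ℕ
    p = suc (h ℕ.+ h)
    0<m₀ : 0 ℕ.< m₀
    0<m₀ = ℕₚ.n≢0⇒n>0 λ m₀≡0 → ℕₚ.1+n≢0 (trans (ℕₚ.+-comm 1 _) (trans a²+b²+1≡ (cong (ℕ._* p) m₀≡0)))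
    -- m₀·p = a² + b² + 1 ≤ 2h² + 1 < p²
    m₀<p : m₀ ℕ.< p
    m₀<p = ℕₚ.*-cancelʳ-< p m₀ p (ℕₚ.≤-<-trans
      (subst (ℕ._≤ h ℕ.* h ℕ.+ h ℕ.* h ℕ.+ 1) a²+b²+1≡
             (ℕₚ.+-monoˡ-≤ 1 (ℕₚ.+-mono-≤ (ℕₚ.*-mono-≤ a≤h a≤h) (ℕₚ.*-mono-≤ b≤h b≤h))))
      (subst (h ℕ.* h ℕ.+ h ℕ.* h ℕ.+ 1 ℕ.<_) (sym (p² h))
             (ℕₚ.m<m+n (h ℕ.* h ℕ.+ h ℕ.* h ℕ.+ 1) (s≤s z≤n))))
      where
      p² : ∀ h → suc (h ℕ.+ h) ℕ.* suc (h ℕ.+ h) ≡ (h ℕ.* h ℕ.+ h ℕ.* h ℕ.+ 1) ℕ.+ (h ℕ.* h ℕ.+ h ℕ.* h ℕ.+ 4 ℕ.* h)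
      p² = ℕ-Solver.solve-∀
    m₀p-squares : FourSquares (+ m₀ * + p)
    m₀p-squares = fourSquares (+ a) (+ b) (+ 1) (+ 0) (begin
      + m₀ * + p                          ≡⟨ sym (ℤₚ.pos-* m₀ p) ⟩
      + (m₀ ℕ.* p)                        ≡⟨ cong +_ (sym a²+b²+1≡) ⟩
      + (a ℕ.* a ℕ.+ b ℕ.* b ℕ.+ 1)       ≡⟨ cong +_ (sym (ℕₚ.+-identityʳ _)) ⟩
      + nsq₄ a b 1 0                      ≡⟨ sym (sq₄-abs (+ a) (+ b) (+ 1) (+ 0)) ⟩
      sq₄ (+ a) (+ b) (+ 1) (+ 0) ∎)

  prime-fourSquares : ∀ p → Prime p → FourSquares (+ p)
  prime-fourSquares p p-prime with p ℕ.≟ 2 | p ℕ.% 2 | ℕ÷.m≡m%n+[m/n]*n p 2 | ℕ÷.m%n<n p 2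
  ... | yes refl | _ | _ | _ = fourSquares (+ 1) (+ 1) (+ 0) (+ 0) refl
  ... | no p≢2 | 0 | p≡2q | _ =
    ⊥-elim (Prime.notComposite p-prime (composite {d = 2} 2<p (divides (p ℕ./ 2) p≡2q)))
    where
    2<p : 2 ℕ.< p
    2<p = ℕₚ.≤∧≢⇒< (ℕ.nonTrivial⇒n>1 p {{prime⇒nonTrivial p-prime}}) (λ 2≡p → p≢2 (sym 2≡p))
  ... | no _ | 1 | p≡2q+1 | _ =
    subst (λ t → FourSquares (+ t)) (sym p≡2h+1) (odd-prime h (subst Prime p≡2h+1 p-prime))
    where
    h : ℕ
    h = p ℕ./ 2
    p≡2h+1 : p ≡ suc (h ℕ.+ h)
    p≡2h+1 = trans p≡2q+1 (cong suc (trans (ℕₚ.*-comm h 2) (cong (h ℕ.+_) (ℕₚ.+-identityʳ h))))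
  ... | no _ | suc (suc _) | _ | s≤s (s≤s ())

  lagrange : ∀ n → FourSquares (+ n)
  lagrange zero = fourSquares (+ 0) (+ 0) (+ 0) (+ 0) refl
  lagrange n@(suc _) with factorise n
  ... | record { factors = ps ; isFactorisation = n≡∏ps ; factorsPrime = all-prime } =
    subst (λ t → FourSquares (+ t)) (sym n≡∏ps) (product-fourSquares ps all-prime)
    where
    product-fourSquares : ∀ ps → All Prime ps → FourSquares (+ product ps)
    product-fourSquares [] [] = fourSquares (+ 1) (+ 0) (+ 0) (+ 0) refl
    product-fourSquares (p ∷ ps) (p-prime ∷ ps-prime) =
      subst FourSquares (sym (ℤₚ.pos-* p (product ps)))
            (fourSquares-* (prime-fourSquares p p-prime) (product-fourSquares ps ps-prime))

module SmallestBound where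
  open import Data.Nat as ℕ using (ℕ; _≤_; _<_)
  import Data.Nat.Properties as ℕₚ
  open import Data.Nat.Induction using (<-rec)
  open import Data.Integer using (ℤ; ∣_∣)
  open import Data.Fin as Fin using (Fin; zero; suc)
  import Data.Fin.Properties as Finₚ
  open import Data.Bool using (true; false)
  open import Data.Vec using (Vec; []; _∷_)
  open import Data.Vec.Relation.Unary.All as VecAll using ([]; _∷_)
  open import Data.List as List using (List; []; _∷_; _++_; filter; concatMap; allFin)
  open import Data.List.Relation.Unary.All as All using (All; []; _∷_)
  open import Data.List.Relation.Unary.Any using (here; there)
  open import Data.List.Membership.Propositional using (_∈_; lose)
  open import Data.List.Membership.Propositional.Properties
    using (∈-allFin; ∈-++⁺ˡ; ∈-++⁺ʳ; ∈-map⁺; ∈-concatMap⁺; ∈-filter⁺; ∈-filter⁻)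
  import Data.List.Membership.DecPropositional as DecMembership
  import Data.Product.Properties as Productₚ
  open import Data.Product using (Σ; _×_; _,_; proj₂)
  open import Data.Empty using (⊥-elim)
  open import Relation.Nullary using (¬_; Dec; yes; no; does)
  open import Relation.Nullary.Decidable using (map′; ¬¬-excluded-middle)
  open import Relation.Binary using (DecidableEquality; tri<; tri≈; tri>)
  open import Relation.Binary.PropositionalEquality using (_≡_; refl; sym; trans; cong)

  -- Equations of E_n are coded by (kind, i, j, k) ∈ Fin 3 × Fin n³; this gives
  -- decidable equality of equations, hence decidable membership in a system.
  Code : ℕ → Set
  Code n = Fin 3 × Fin n × Fin n × Fin n

  encode : ∀ {n} → Equation n → Code n
  encode (one i)     = zero , i , i , i
  encode (add i j k) = suc zero , i , j , k
  encode (mul i j k) = suc (suc zero) , i , j , k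

  decode : ∀ {n} → Code n → Equation n
  decode (zero , i , _ , _)                = one i
  decode (suc zero , i , j , k)            = add i j k
  decode (suc (suc zero) , i , j , k)      = mul i j k

  decode-encode : ∀ {n} (e : Equation n) → decode (encode e) ≡ e
  decode-encode (one i)     = refl
  decode-encode (add i j k) = refl
  decode-encode (mul i j k) = refl

  _≟ₑ_ : ∀ {n} → DecidableEquality (Equation n)
  e ≟ₑ f = map′ (λ same → trans (sym (decode-encode e)) (trans (cong decode same) (decode-encode f)))
                (cong encode) (≟-code (encode e) (encode f))
    where
    ≟-code : ∀ {n} → DecidableEquality (Code n)
    ≟-code = Productₚ.≡-dec Finₚ._≟_ (Productₚ.≡-dec Finₚ._≟_ (Productₚ.≡-dec Finₚ._≟_ Finₚ._≟_))

  binary : ∀ {n} → Fin n → Fin n → Fin n → List (Equation n)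
  binary i j k = add i j k ∷ mul i j k ∷ []

  binaryEquations : ∀ n → List (Equation n)
  binaryEquations n = concatMap (λ i → concatMap (λ j → concatMap (binary i j) (allFin n)) (allFin n)) (allFin n)

  allEquations : ∀ n → List (Equation n)
  allEquations n = List.map one (allFin n) ++ binaryEquations n

  ∈-binaryEquations : ∀ {n} i j k {e : Equation n} → e ∈ binary i j k → e ∈ binaryEquations n
  ∈-binaryEquations {n} i j k e∈ =
    ∈-concatMap⁺ (λ i → concatMap (λ j → concatMap (binary i j) (allFin n)) (allFin n)) (lose (∈-allFin i)
      (∈-concatMap⁺ (λ j → concatMap (binary i j) (allFin n)) (lose (∈-allFin j)
        (∈-concatMap⁺ (binary i j) (lose (∈-allFin k) e∈)))))

  ∈-allEquations : ∀ {n} (e : Equation n) → e ∈ allEquations n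
  ∈-allEquations     (one i)     = ∈-++⁺ˡ (∈-map⁺ one (∈-allFin i))
  ∈-allEquations {n} (add i j k) = ∈-++⁺ʳ (List.map one (allFin n)) (∈-binaryEquations i j k (here refl))
  ∈-allEquations {n} (mul i j k) = ∈-++⁺ʳ (List.map one (allFin n)) (∈-binaryEquations i j k (there (here refl)))

  sublists : ∀ {A : Set} → List A → List (List A)
  sublists []       = [] ∷ []
  sublists (x ∷ xs) = List.map (x ∷_) (sublists xs) ++ sublists xs

  filter-∈-sublists : ∀ {A : Set} {P : A → Set} (P? : ∀ x → Dec (P x)) xs → filter P? xs ∈ sublists xs
  filter-∈-sublists P? []       = here refl
  filter-∈-sublists P? (x ∷ xs) with does (P? x)
  ... | true  = ∈-++⁺ˡ (∈-map⁺ (x ∷_) (filter-∈-sublists P? xs))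
  ... | false = ∈-++⁺ʳ (List.map (x ∷_) (sublists xs)) (filter-∈-sublists P? xs)

  solution-⊆ : ∀ {n} {S T : System n} {x} → (∀ {e} → e ∈ T → e ∈ S) → Solution S x → Solution T x
  solution-⊆ T⊆S sol = All.tabulate (λ e∈T → All.lookup sol (T⊆S e∈T))

  -- The canonical form of S: the equations of E_n, in a fixed order, occurring in S.
  -- There are only finitely many canonical systems, namely sublists of allEquations n.
  module Canonical {n} (S : System n) where
    open DecMembership (_≟ₑ_ {n}) using (_∈?_)

    canonical : System n
    canonical = filter (_∈? S) (allEquations n)

    canonical-⊆ : ∀ {e} → e ∈ canonical → e ∈ S
    canonical-⊆ e∈ = proj₂ (∈-filter⁻ (_∈? S) {xs = allEquations n} e∈)

    ⊆-canonical : ∀ {e} → e ∈ S → e ∈ canonical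
    ⊆-canonical e∈S = ∈-filter⁺ (_∈? S) (∈-allEquations _) e∈S

    canonical-∈ : canonical ∈ sublists (allEquations n)
    canonical-∈ = filter-∈-sublists (_∈? S) (allEquations n)

    finite-canonical : FinitelyManySolutions S → FinitelyManySolutions canonical
    finite-canonical (L , complete) = L , λ x sol → complete x (solution-⊆ ⊆-canonical sol)

  ∥_∥ : ∀ {n} → Vec ℤ n → ℕ
  ∥ [] ∥    = 0
  ∥ z ∷ x ∥ = ∣ z ∣ ℕ.+ ∥ x ∥

  ∥_∥* : ∀ {n} → List (Vec ℤ n) → ℕ
  ∥ [] ∥*    = 0
  ∥ x ∷ L ∥* = ∥ x ∥ ℕ.+ ∥ L ∥*

  inBox-mono : ∀ {n} {b c} (x : Vec ℤ n) → b ≤ c → InBox b x → InBox c x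
  inBox-mono x b≤c = VecAll.map (λ z≤b → ℕₚ.≤-trans z≤b b≤c)

  inBox-∥∥ : ∀ {n} (x : Vec ℤ n) → InBox ∥ x ∥ x
  inBox-∥∥ []      = []
  inBox-∥∥ (z ∷ x) = ℕₚ.m≤m+n ∣ z ∣ ∥ x ∥ ∷ inBox-mono x (ℕₚ.m≤n+m ∥ x ∥ ∣ z ∣) (inBox-∥∥ x)

  inBox-∥∥* : ∀ {n} (L : List (Vec ℤ n)) {x} → x ∈ L → InBox ∥ L ∥* x
  inBox-∥∥* (x ∷ L) (here refl) = inBox-mono x (ℕₚ.m≤m+n ∥ x ∥ ∥ L ∥*) (inBox-∥∥ x)
  inBox-∥∥* (y ∷ L) {x} (there x∈L) = inBox-mono x (ℕₚ.m≤n+m ∥ L ∥* ∥ y ∥) (inBox-∥∥* L x∈L)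

  ¬¬-decide-all : ∀ {A : Set} (P : A → Set) xs → ¬ ¬ All (λ x → Dec (P x)) xs
  ¬¬-decide-all P []       k = k []
  ¬¬-decide-all P (x ∷ xs) k = ¬¬-excluded-middle λ d → ¬¬-decide-all P xs λ ds → k (d ∷ ds)

  -- Given a decision of finiteness for every canonical system, the sum of the bounds
  -- of the finite ones bounds every finite-solution system.
  module _ {n : ℕ} where
    Decisions : Set
    Decisions = All (λ T → Dec (FinitelyManySolutions {n} T)) (sublists (allEquations n))

    decisionBound : ∀ {T : System n} → Dec (FinitelyManySolutions T) → ℕ
    decisionBound (yes (L , _)) = ∥ L ∥*
    decisionBound (no _)        = 0

    totalBound : ∀ {Ts} → All (λ T → Dec (FinitelyManySolutions {n} T)) Ts → ℕ
    totalBound []       = 0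
    totalBound (d ∷ ds) = decisionBound d ℕ.+ totalBound ds

    totalBound-≥ : ∀ {Ts} (ds : All (λ T → Dec (FinitelyManySolutions {n} T)) Ts) {T} (T∈ : T ∈ Ts) →
                   decisionBound (All.lookup ds T∈) ≤ totalBound ds
    totalBound-≥ (d ∷ ds) (here refl) = ℕₚ.m≤m+n (decisionBound d) (totalBound ds)
    totalBound-≥ (d ∷ ds) (there T∈)  = ℕₚ.≤-trans (totalBound-≥ ds T∈) (ℕₚ.m≤n+m (totalBound ds) (decisionBound d))

    totalBound-isBound : (ds : Decisions) → IsBound n (totalBound ds)
    totalBound-isBound ds S finite x sol = bound (All.lookup ds canonical-∈) (totalBound-≥ ds canonical-∈)
      where
      open Canonical S
      bound : (d : Dec (FinitelyManySolutions canonical)) → decisionBound d ≤ totalBound ds → InBox (totalBound ds) x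
      bound (yes (L , complete)) ≤total = inBox-mono x ≤total (inBox-∥∥* L (complete x (solution-⊆ canonical-⊆ sol)))
      bound (no infinite)        _      = ⊥-elim (infinite (finite-canonical finite))

  bound-exists : ∀ n → ¬ ¬ Σ ℕ (IsBound n)
  bound-exists n no-bound = ¬¬-decide-all FinitelyManySolutions (sublists (allEquations n))
                              λ ds → no-bound (totalBound ds , totalBound-isBound ds)

  ¬¬-least : ∀ (Q : ℕ → Set) b → Q b → ¬ ¬ Σ ℕ λ v → Q v × (∀ b → b < v → ¬ Q b)
  ¬¬-least Q b Qb no-least = <-rec (λ b → ¬ Q b) (λ b smaller Qb → no-least (b , Qb , λ b′ b′<b → smaller b′<b)) b Qb

  f-exists : ∀ n → ¬ ¬ Σ ℕ (FGraph n)
  f-exists n no-f = bound-exists n λ (b , isBound) → ¬¬-least (IsBound n) b isBound no-f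

  f-unique : ∀ {n v w} → FGraph n v → FGraph n w → v ≡ w
  f-unique {n} {v} {w} (v-bound , v-least) (w-bound , w-least) with ℕₚ.<-cmp v w
  ... | tri≈ _ v≡w _ = v≡w
  ... | tri< v<w _ _ = ⊥-elim (w-least v v<w v-bound)
  ... | tri> _ _ w<v = ⊥-elim (v-least w w<v w-bound)

module StraightLinePrograms where
  open import Data.Nat as ℕ using (ℕ; zero; suc; z≤n; s≤s; _≤_; _<_)
  import Data.Nat.Properties as ℕₚ
  open import Data.Integer using (ℤ; +_; -[1+_]; ∣_∣; _+_; _*_; _-_)
  import Data.Integer.Properties as ℤₚ
  open import Data.Integer.Tactic.RingSolver using (solve-∀)
  import Data.Nat.Tactic.RingSolver as ℕ-Solver
  open import Data.List using (List; []; _∷_; length)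
  open import Data.List.Relation.Unary.All using (All; []; _∷_)
  open import Data.Product using (_×_; _,_)
  open import Data.Sum using (inj₁; inj₂)
  open import Data.Unit using (⊤; tt)
  open import Data.Empty using (⊥-elim)
  open import Relation.Nullary using (yes; no)
  open import Relation.Binary.PropositionalEquality

  -- Computational instructions; each defines one new variable.
  data Op : Set where
    unit  : Op
    plus  : ℕ → ℕ → Op
    minus : ℕ → ℕ → Op      -- x = xₐ − x_b, imposed as x_b + x = xₐ
    times : ℕ → ℕ → Op

  -- An instruction is an operation or an input, i.e. an unconstrained variable;
  -- an input records the value it takes in the intended solution.
  data Instr : Set where
    op    : Op → Instr
    input : ℤ → Instr

  -- A straight-line program, newest instruction first: the head of i ∷ P defines
  -- the variable with index length P.
  Program : Set
  Program = List Instr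

  data Constraint : Set where
    is-one  : ℕ → Constraint
    is-sum  : ℕ → ℕ → ℕ → Constraint
    is-prod : ℕ → ℕ → ℕ → Constraint

  Valuation : Set
  Valuation = ℕ → ℤ

  Holds : Valuation → Constraint → Set
  Holds σ (is-one i)      = σ i ≡ + 1
  Holds σ (is-sum i j k)  = σ i + σ j ≡ σ k
  Holds σ (is-prod i j k) = σ i * σ j ≡ σ k

  opConstraint : ℕ → Op → Constraint
  opConstraint p unit        = is-one p
  opConstraint p (plus a b)  = is-sum a b p
  opConstraint p (minus a b) = is-sum b p a
  opConstraint p (times a b) = is-prod a b p

  constraints : Program → List Constraint
  constraints []              = []
  constraints (op o ∷ P)      = opConstraint (length P) o ∷ constraints P
  constraints (input _ ∷ P)   = constraints P

  opValue : Valuation → Op → ℤ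
  opValue σ unit        = + 1
  opValue σ (plus a b)  = σ a + σ b
  opValue σ (minus a b) = σ a - σ b
  opValue σ (times a b) = σ a * σ b

  instrValue : Valuation → Instr → ℤ
  instrValue σ (op o)    = opValue σ o
  instrValue σ (input z) = z

  update : Valuation → ℕ → ℤ → Valuation
  update σ p v k with k ℕ.≟ p
  ... | yes _ = v
  ... | no  _ = σ k

  update-here : ∀ σ p v → update σ p v p ≡ v
  update-here σ p v with p ℕ.≟ p
  ... | yes _   = refl
  ... | no  p≢p = ⊥-elim (p≢p refl)

  update-below : ∀ σ p v k → k < p → update σ p v k ≡ σ k
  update-below σ p v k k<p with k ℕ.≟ p
  ... | yes refl = ⊥-elim (ℕₚ.<-irrefl refl k<p)
  ... | no  _    = refl

  run : Program → Valuation
  run []      = λ _ → + 0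
  run (i ∷ P) = update (run P) (length P) (instrValue (run P) i)

  OperandsBelow : ℕ → Op → Set
  OperandsBelow p unit        = ⊤
  OperandsBelow p (plus a b)  = a < p × b < p
  OperandsBelow p (minus a b) = a < p × b < p
  OperandsBelow p (times a b) = a < p × b < p

  WellFormed : Program → Set
  WellFormed []            = ⊤
  WellFormed (op o ∷ P)    = OperandsBelow (length P) o × WellFormed P
  WellFormed (input _ ∷ P) = WellFormed P

  Within : ℕ → Constraint → Set
  Within n (is-one i)      = i < n
  Within n (is-sum i j k)  = i < n × j < n × k < n
  Within n (is-prod i j k) = i < n × j < n × k < n

  within-mono : ∀ {m n} c → m ≤ n → Within m c → Within n c
  within-mono (is-one i)      m≤n i<m               = ℕₚ.<-≤-trans i<m m≤n
  within-mono (is-sum i j k)  m≤n (i<m , j<m , k<m) = ℕₚ.<-≤-trans i<m m≤n , ℕₚ.<-≤-trans j<m m≤n , ℕₚ.<-≤-trans k<m m≤n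
  within-mono (is-prod i j k) m≤n (i<m , j<m , k<m) = ℕₚ.<-≤-trans i<m m≤n , ℕₚ.<-≤-trans j<m m≤n , ℕₚ.<-≤-trans k<m m≤n

  all-within-mono : ∀ {m n} cs → m ≤ n → All (Within m) cs → All (Within n) cs
  all-within-mono []       m≤n []       = []
  all-within-mono (c ∷ cs) m≤n (w ∷ ws) = within-mono c m≤n w ∷ all-within-mono cs m≤n ws

  constraints-within : ∀ P → WellFormed P → All (Within (length P)) (constraints P)
  constraints-within []            _         = []
  constraints-within (input _ ∷ P) wf        = all-within-mono (constraints P) (ℕₚ.n≤1+n _) (constraints-within P wf)
  constraints-within (op o ∷ P)    (ob , wf) =
    new o ob ∷ all-within-mono (constraints P) (ℕₚ.n≤1+n _) (constraints-within P wf)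
    where
    p : ℕ
    p = length P
    new : ∀ o → OperandsBelow p o → Within (suc p) (opConstraint p o)
    new unit        _         = ℕₚ.n<1+n p
    new (plus a b)  (a<p , b<p) = ℕₚ.m<n⇒m<1+n a<p , ℕₚ.m<n⇒m<1+n b<p , ℕₚ.n<1+n p
    new (minus a b) (a<p , b<p) = ℕₚ.m<n⇒m<1+n b<p , ℕₚ.n<1+n p , ℕₚ.m<n⇒m<1+n a<p
    new (times a b) (a<p , b<p) = ℕₚ.m<n⇒m<1+n a<p , ℕₚ.m<n⇒m<1+n b<p , ℕₚ.n<1+n p

  Agree : ℕ → Valuation → Valuation → Set
  Agree n σ τ = ∀ k → k < n → σ k ≡ τ k

  holds-agree : ∀ {n σ τ} c → Within n c → Agree n σ τ → Holds σ c → Holds τ c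
  holds-agree (is-one i)      i<n σ≈τ h = trans (sym (σ≈τ i i<n)) h
  holds-agree (is-sum i j k)  (i<n , j<n , k<n) σ≈τ h =
    trans (sym (cong₂ _+_ (σ≈τ i i<n) (σ≈τ j j<n))) (trans h (σ≈τ k k<n))
  holds-agree (is-prod i j k) (i<n , j<n , k<n) σ≈τ h =
    trans (sym (cong₂ _*_ (σ≈τ i i<n) (σ≈τ j j<n))) (trans h (σ≈τ k k<n))

  all-holds-agree : ∀ {n σ τ} cs → All (Within n) cs → Agree n σ τ → All (Holds σ) cs → All (Holds τ) cs
  all-holds-agree []       []       σ≈τ []       = []
  all-holds-agree (c ∷ cs) (w ∷ ws) σ≈τ (h ∷ hs) = holds-agree c w σ≈τ h ∷ all-holds-agree cs ws σ≈τ hs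

  run-∷ : ∀ i P → Agree (length P) (run P) (run (i ∷ P))
  run-∷ i P k k<p = sym (update-below (run P) (length P) _ k k<p)

  run-opConstraint : ∀ o P → OperandsBelow (length P) o → Holds (run (op o ∷ P)) (opConstraint (length P) o)
  run-opConstraint unit        P _ = update-here (run P) (length P) (+ 1)
  run-opConstraint (plus a b)  P (a<p , b<p) =
    trans (cong₂ _+_ (sym (run-∷ (op (plus a b)) P a a<p)) (sym (run-∷ (op (plus a b)) P b b<p))) (sym (update-here (run P) (length P) _))
  run-opConstraint (times a b) P (a<p , b<p) =
    trans (cong₂ _*_ (sym (run-∷ (op (times a b)) P a a<p)) (sym (run-∷ (op (times a b)) P b b<p))) (sym (update-here (run P) (length P) _))
  run-opConstraint (minus a b) P (a<p , b<p) =
    trans (cong₂ _+_ (sym (run-∷ (op (minus a b)) P b b<p)) (update-here (run P) (length P) _))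
          (trans (add-sub (run P a) (run P b)) (run-∷ (op (minus a b)) P a a<p))
    where
    add-sub : ∀ u v → v + (u - v) ≡ u
    add-sub = solve-∀

  run-satisfies : ∀ P → WellFormed P → All (Holds (run P)) (constraints P)
  run-satisfies []            _         = []
  run-satisfies (input z ∷ P) wf        =
    all-holds-agree (constraints P) (constraints-within P wf) (run-∷ (input z) P) (run-satisfies P wf)
  run-satisfies (op o ∷ P)    (ob , wf) = run-opConstraint o P ob ∷
    all-holds-agree (constraints P) (constraints-within P wf) (run-∷ (op o) P) (run-satisfies P wf)

  -- tower M k = M^(2^k), the sequence M, M², M⁴, … of repeated squares.
  tower : ℕ → ℕ → ℕ
  tower M zero    = M
  tower M (suc k) = tower M k ℕ.* tower M k

  tower-≥ : ∀ {M} → 1 ≤ M → ∀ k → M ≤ tower M k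
  tower-step : ∀ {M} → 1 ≤ M → ∀ k → tower M k ≤ tower M (suc k)
  tower-≥ 1≤M zero    = ℕₚ.≤-refl
  tower-≥ 1≤M (suc k) = ℕₚ.≤-trans (tower-≥ 1≤M k) (tower-step 1≤M k)
  tower-step {M} 1≤M k = ℕₚ.m≤m*n (tower M k) (tower M k) {{ℕ.>-nonZero (ℕₚ.≤-trans 1≤M (tower-≥ 1≤M k))}}

  tower-mono : ∀ {M} → 1 ≤ M → ∀ {j k} → j ≤ k → tower M j ≤ tower M k
  tower-mono 1≤M {j} {zero}  z≤n = ℕₚ.≤-refl
  tower-mono 1≤M {j} {suc k} j≤1+k with ℕₚ.m≤n⇒m<n∨m≡n j≤1+k
  ... | inj₂ refl        = ℕₚ.≤-refl
  ... | inj₁ (s≤s j≤k)   =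
    ℕₚ.≤-trans (tower-mono 1≤M j≤k) (tower-step 1≤M k)

  tower-+ : ∀ {M} → 2 ≤ M → ∀ {a b p} → a < p → b < p → tower M a ℕ.+ tower M b ≤ tower M p
  tower-+ {M} 2≤M {a} {b} {suc p} (s≤s a≤p) (s≤s b≤p) = ℕₚ.≤-trans
    (ℕₚ.+-mono-≤ (tower-mono 1≤M a≤p) (tower-mono 1≤M b≤p))
    (subst (_≤ tower M p ℕ.* tower M p) (double (tower M p))
           (ℕₚ.*-monoʳ-≤ (tower M p) (ℕₚ.≤-trans 2≤M (tower-≥ 1≤M p))))
    where
    1≤M : 1 ≤ M
    1≤M = ℕₚ.≤-trans (s≤s z≤n) 2≤M
    double : ∀ x → x ℕ.* 2 ≡ x ℕ.+ x
    double x = trans (ℕₚ.*-comm x 2) (cong (x ℕ.+_) (ℕₚ.+-identityʳ x))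

  tower-* : ∀ {M} → 1 ≤ M → ∀ {a b p} → a < p → b < p → tower M a ℕ.* tower M b ≤ tower M p
  tower-* 1≤M {a} {b} {suc p} (s≤s a≤p) (s≤s b≤p) = ℕₚ.*-mono-≤ (tower-mono 1≤M a≤p) (tower-mono 1≤M b≤p)

  sum⇒difference : ∀ {u v w} → v + w ≡ u → w ≡ u - v
  sum⇒difference {u} {v} {w} v+w≡u = trans (add-sub v w) (cong (_- v) v+w≡u)
    where
    add-sub : ∀ v w → w ≡ (v + w) - v
    add-sub = solve-∀

  InputsBounded : ℕ → Valuation → Program → Set
  InputsBounded c σ []            = ⊤
  InputsBounded c σ (input _ ∷ P) = ∣ σ (length P) ∣ ≤ c × InputsBounded c σ P
  InputsBounded c σ (op _ ∷ P)    = InputsBounded c σ P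

  below-suc : ∀ {Q : ℕ → Set} p → (∀ k → k < p → Q k) → Q p → ∀ k → k < suc p → Q k
  below-suc p below at-p k (s≤s k≤p) with ℕₚ.m≤n⇒m<n∨m≡n k≤p
  ... | inj₁ k<p  = below k k<p
  ... | inj₂ refl = at-p

  module _ (c : ℕ) (σ : Valuation) where
    private
      B : ℕ → ℕ
      B = tower (2 ℕ.+ c)
      1≤2+c : 1 ≤ 2 ℕ.+ c
      1≤2+c = s≤s z≤n

    op-bound : ∀ {p} o → OperandsBelow p o → Holds σ (opConstraint p o) →
               (∀ k → k < p → ∣ σ k ∣ ≤ B k) → ∣ σ p ∣ ≤ B p
    op-bound {p} unit        _ σp≡1 _ =
      subst (λ t → ∣ t ∣ ≤ B p) (sym σp≡1) (ℕₚ.≤-trans (s≤s z≤n) (tower-≥ 1≤2+c p))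
    op-bound {p} (plus a b)  (a<p , b<p) sum≡ bound = subst (λ t → ∣ t ∣ ≤ B p) sum≡
      (ℕₚ.≤-trans (ℤₚ.∣i+j∣≤∣i∣+∣j∣ (σ a) (σ b))
        (ℕₚ.≤-trans (ℕₚ.+-mono-≤ (bound a a<p) (bound b b<p)) (tower-+ (s≤s (s≤s z≤n)) a<p b<p)))
    op-bound {p} (minus a b) (a<p , b<p) sum≡ bound = subst (λ t → ∣ t ∣ ≤ B p) (sym (sum⇒difference sum≡))
      (ℕₚ.≤-trans (ℤₚ.∣i-j∣≤∣i∣+∣j∣ (σ a) (σ b))
        (ℕₚ.≤-trans (ℕₚ.+-mono-≤ (bound a a<p) (bound b b<p)) (tower-+ (s≤s (s≤s z≤n)) a<p b<p)))
    op-bound {p} (times a b) (a<p , b<p) prod≡ bound = subst (λ t → ∣ t ∣ ≤ B p) prod≡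
      (subst (_≤ B p) (sym (ℤₚ.abs-* (σ a) (σ b)))
        (ℕₚ.≤-trans (ℕₚ.*-mono-≤ (bound a a<p) (bound b b<p)) (tower-* 1≤2+c a<p b<p)))

    -- Every solution of a well-formed program whose inputs are bounded by c is
    -- bounded by tower (2 + c) k at variable k: each variable is 1, an input, or a
    -- sum, difference or product of two earlier ones.
    solution-bound : ∀ P → WellFormed P → All (Holds σ) (constraints P) → InputsBounded c σ P →
                     ∀ k → k < length P → ∣ σ k ∣ ≤ B k
    solution-bound []            _         _            _              k ()
    solution-bound (input _ ∷ P) wf        sat          (σp≤c , inputs) =
      below-suc (length P) (solution-bound P wf sat inputs)
        (ℕₚ.≤-trans σp≤c (ℕₚ.≤-trans (ℕₚ.m≤n+m c 2) (tower-≥ 1≤2+c (length P))))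
    solution-bound (op o ∷ P)    (ob , wf) (new ∷ sat)  inputs =
      below-suc (length P) (solution-bound P wf sat inputs) (op-bound o ob new (solution-bound P wf sat inputs))

  infix 4 _⊒_ _⊒ᶜ_
  infixr 5 _◅_ _◅ᶜ_
  data _⊒_ : Program → Program → Set where
    ε   : ∀ {P} → P ⊒ P
    _◅_ : ∀ {P′ P} i → P′ ⊒ P → i ∷ P′ ⊒ P

  data _⊒ᶜ_ : Program → Program → Set where
    εᶜ   : ∀ {P} → P ⊒ᶜ P
    _◅ᶜ_ : ∀ {P′ P} o → P′ ⊒ᶜ P → op o ∷ P′ ⊒ᶜ P

  ⊒-trans : ∀ {P″ P′ P} → P″ ⊒ P′ → P′ ⊒ P → P″ ⊒ P
  ⊒-trans ε        ext = ext
  ⊒-trans (i ◅ e₁) ext = i ◅ ⊒-trans e₁ ext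

  ⊒ᶜ-trans : ∀ {P″ P′ P} → P″ ⊒ᶜ P′ → P′ ⊒ᶜ P → P″ ⊒ᶜ P
  ⊒ᶜ-trans εᶜ        ext = ext
  ⊒ᶜ-trans (o ◅ᶜ e₁) ext = o ◅ᶜ ⊒ᶜ-trans e₁ ext

  ⊒ᶜ⇒⊒ : ∀ {P′ P} → P′ ⊒ᶜ P → P′ ⊒ P
  ⊒ᶜ⇒⊒ εᶜ        = ε
  ⊒ᶜ⇒⊒ (o ◅ᶜ ext) = op o ◅ ⊒ᶜ⇒⊒ ext

  ⊒-constraints : ∀ {σ P′ P} → P′ ⊒ P → All (Holds σ) (constraints P′) → All (Holds σ) (constraints P)
  ⊒-constraints ε               sat       = sat
  ⊒-constraints (op _ ◅ ext)    (_ ∷ sat) = ⊒-constraints ext sat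
  ⊒-constraints (input _ ◅ ext) sat       = ⊒-constraints ext sat

  ⊒-length : ∀ {P′ P} → P′ ⊒ P → length P ≤ length P′
  ⊒-length ε         = ℕₚ.≤-refl
  ⊒-length (i ◅ ext) = ℕₚ.m≤n⇒m≤1+n (⊒-length ext)

  ⊒-run : ∀ {P′ P} → P′ ⊒ P → Agree (length P) (run P) (run P′)
  ⊒-run ε                     k k<p = refl
  ⊒-run (_◅_ {P′} i ext) k k<p = trans (⊒-run ext k k<p) (run-∷ i P′ k (ℕₚ.<-≤-trans k<p (⊒-length ext)))

  ⊒ᶜ-inputsBounded : ∀ {c σ P′ P} → P′ ⊒ᶜ P → InputsBounded c σ P → InputsBounded c σ P′
  ⊒ᶜ-inputsBounded εᶜ         bounded = bounded
  ⊒ᶜ-inputsBounded (o ◅ᶜ ext) bounded = ⊒ᶜ-inputsBounded ext bounded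

  infixl 6 _⊞_
  infixl 7 _⊠_
  data Expr : Set where
    ref     : ℕ → Expr
    lit     : ℤ → Expr
    _⊞_ _⊠_ : Expr → Expr → Expr

  evalExpr : Valuation → Expr → ℤ
  evalExpr σ (ref i) = σ i
  evalExpr σ (lit z) = z
  evalExpr σ (e ⊞ f) = evalExpr σ e + evalExpr σ f
  evalExpr σ (e ⊠ f) = evalExpr σ e * evalExpr σ f

  RefsBelow : ℕ → Expr → Set
  RefsBelow n (ref i) = i < n
  RefsBelow n (lit _) = ⊤
  RefsBelow n (e ⊞ f) = RefsBelow n e × RefsBelow n f
  RefsBelow n (e ⊠ f) = RefsBelow n e × RefsBelow n f

  refsBelow-mono : ∀ {m n} e → m ≤ n → RefsBelow m e → RefsBelow n e
  refsBelow-mono (ref i) m≤n i<m       = ℕₚ.<-≤-trans i<m m≤n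
  refsBelow-mono (lit _) m≤n _         = tt
  refsBelow-mono (e ⊞ f) m≤n (re , rf) = refsBelow-mono e m≤n re , refsBelow-mono f m≤n rf
  refsBelow-mono (e ⊠ f) m≤n (re , rf) = refsBelow-mono e m≤n re , refsBelow-mono f m≤n rf

  size : Expr → ℕ
  size (ref _)        = 0
  size (lit (+ k))    = suc k
  size (lit -[1+ k ]) = 4 ℕ.+ k
  size (e ⊞ f)        = suc (size f ℕ.+ size e)
  size (e ⊠ f)        = suc (size f ℕ.+ size e)

  record Compiled (P : Program) : Set where
    constructor compiled
    field
      code    : Program
      out     : ℕ
      extends : code ⊒ᶜ P
  open Compiled public

  -- The compiler assumes variable 0 is constrained to 1.
  -- The natural k: 0 = x₀ − x₀, then k additions of x₀.
  natural : ℕ → (P : Program) → Compiled P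
  natural zero    P = compiled (op (minus 0 0) ∷ P) (length P) (minus 0 0 ◅ᶜ εᶜ)
  natural (suc k) P = compiled (op (plus (out N) 0) ∷ code N) (length (code N)) (plus (out N) 0 ◅ᶜ extends N)
    where
    N : Compiled P
    N = natural k P

  -- The integer −(k + 1) = x₀ − (k + 2).
  integer : ℤ → (P : Program) → Compiled P
  integer (+ k)    P = natural k P
  integer -[1+ k ] P = compiled (op (minus 0 (out N)) ∷ code N) (length (code N)) (minus 0 (out N) ◅ᶜ extends N)
    where
    N : Compiled P
    N = natural (suc (suc k)) P

  compile : Expr → (P : Program) → Compiled P
  compile (ref i) P = compiled P i εᶜ
  compile (lit z) P = integer z P
  compile (e ⊞ f) P = compiled (op (plus (out E) (out F)) ∷ code F) (length (code F))
                               (plus (out E) (out F) ◅ᶜ ⊒ᶜ-trans (extends F) (extends E))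
    where
    E : Compiled P
    E = compile e P
    F : Compiled (code E)
    F = compile f (code E)
  compile (e ⊠ f) P = compiled (op (times (out E) (out F)) ∷ code F) (length (code F))
                               (times (out E) (out F) ◅ᶜ ⊒ᶜ-trans (extends F) (extends E))
    where
    E : Compiled P
    E = compile e P
    F : Compiled (code E)
    F = compile f (code E)

  compiled-length : ∀ {P} (C : Compiled P) → length P ≤ length (code C)
  compiled-length C = ⊒-length (⊒ᶜ⇒⊒ (extends C))

  module _ {σ : Valuation} (x₀≡1 : σ 0 ≡ + 1) where
    natural-correct : ∀ k P → All (Holds σ) (constraints (code (natural k P))) → σ (out (natural k P)) ≡ + k
    natural-correct zero    P (x₀+x≡x₀ ∷ _)  = trans (sum⇒difference x₀+x≡x₀) (ℤₚ.+-inverseʳ (σ 0))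
    natural-correct (suc k) P (x+x₀≡x′ ∷ sat) = begin
      σ (length (code (natural k P)))  ≡⟨ sym x+x₀≡x′ ⟩
      σ (out (natural k P)) + σ 0      ≡⟨ cong₂ _+_ (natural-correct k P sat) x₀≡1 ⟩
      + k + + 1                        ≡⟨ sym (ℤₚ.pos-+ k 1) ⟩
      + (k ℕ.+ 1)                      ≡⟨ cong +_ (ℕₚ.+-comm k 1) ⟩
      + suc k ∎
      where open ≡-Reasoning

    integer-correct : ∀ z P → All (Holds σ) (constraints (code (integer z P))) → σ (out (integer z P)) ≡ z
    integer-correct (+ k)    P sat              = natural-correct k P sat
    integer-correct -[1+ k ] P (n+x≡x₀ ∷ sat) =
      trans (sum⇒difference n+x≡x₀) (cong₂ _-_ x₀≡1 (natural-correct (suc (suc k)) P sat))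

    compile-correct : ∀ e P → All (Holds σ) (constraints (code (compile e P))) → σ (out (compile e P)) ≡ evalExpr σ e
    compile-correct (ref i) P sat = refl
    compile-correct (lit z) P sat = integer-correct z P sat
    compile-correct (e ⊞ f) P (new ∷ sat) = trans (sym new) (cong₂ _+_
      (compile-correct e P (⊒-constraints (⊒ᶜ⇒⊒ (extends (compile f (code (compile e P))))) sat))
      (compile-correct f (code (compile e P)) sat))
    compile-correct (e ⊠ f) P (new ∷ sat) = trans (sym new) (cong₂ _*_
      (compile-correct e P (⊒-constraints (⊒ᶜ⇒⊒ (extends (compile f (code (compile e P))))) sat))
      (compile-correct f (code (compile e P)) sat))

  WellCompiled : ∀ {P} → Compiled P → Set
  WellCompiled C = WellFormed (code C) × out C < length (code C)

  natural-wf : ∀ k P → 0 < length P → WellFormed P → WellCompiled (natural k P)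
  natural-wf zero    P 0<p wf = ((0<p , 0<p) , wf) , ℕₚ.n<1+n (length P)
  natural-wf (suc k) P 0<p wf with natural-wf k P 0<p wf
  ... | wfN , out<N =
    ((out<N , ℕₚ.<-≤-trans 0<p (compiled-length (natural k P))) , wfN) , ℕₚ.n<1+n _

  integer-wf : ∀ z P → 0 < length P → WellFormed P → WellCompiled (integer z P)
  integer-wf (+ k)    P 0<p wf = natural-wf k P 0<p wf
  integer-wf -[1+ k ] P 0<p wf with natural-wf (suc (suc k)) P 0<p wf
  ... | wfN , out<N =
    ((ℕₚ.<-≤-trans 0<p (compiled-length (natural (suc (suc k)) P)) , out<N) , wfN) , ℕₚ.n<1+n _

  compile-wf : ∀ e P → 0 < length P → RefsBelow (length P) e → WellFormed P → WellCompiled (compile e P)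

  binary-wf : ∀ e f P → 0 < length P → RefsBelow (length P) e → RefsBelow (length P) f → WellFormed P →
    let E = compile e P ; F = compile f (code E) in
    WellFormed (code F) × out E < length (code F) × out F < length (code F)
  compile-wf (ref i) P 0<p i<p     wf = wf , i<p
  compile-wf (lit z) P 0<p _       wf = integer-wf z P 0<p wf
  compile-wf (e ⊞ f) P 0<p (re , rf) wf with binary-wf e f P 0<p re rf wf
  ... | wfF , outE< , outF< = ((outE< , outF<) , wfF) , ℕₚ.n<1+n _
  compile-wf (e ⊠ f) P 0<p (re , rf) wf with binary-wf e f P 0<p re rf wf
  ... | wfF , outE< , outF< = ((outE< , outF<) , wfF) , ℕₚ.n<1+n _

  binary-wf e f P 0<p re rf wf with compile-wf e P 0<p re wf
  ... | wfE , outE< with compile-wf f (code (compile e P)) (ℕₚ.<-≤-trans 0<p (compiled-length (compile e P)))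
                          (refsBelow-mono f (compiled-length (compile e P)) rf) wfE
  ... | wfF , outF< = wfF , ℕₚ.<-≤-trans outE< (compiled-length (compile f (code (compile e P)))) , outF<

  natural-length : ∀ k P → length (code (natural k P)) ≡ suc k ℕ.+ length P
  natural-length zero    P = refl
  natural-length (suc k) P = cong suc (natural-length k P)

  compile-length : ∀ e P → length (code (compile e P)) ≡ size e ℕ.+ length P
  binary-length : ∀ e f P → length (code (compile f (code (compile e P)))) ≡ size f ℕ.+ size e ℕ.+ length P
  compile-length (ref i)        P = refl
  compile-length (lit (+ k))    P = natural-length k P
  compile-length (lit -[1+ k ]) P = cong suc (natural-length (suc (suc k)) P)
  compile-length (e ⊞ f)        P = cong suc (binary-length e f P)
  compile-length (e ⊠ f)        P = cong suc (binary-length e f P)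

  binary-length e f P = begin
    length (code (compile f (code (compile e P))))   ≡⟨ compile-length f (code (compile e P)) ⟩
    size f ℕ.+ length (code (compile e P))           ≡⟨ cong (size f ℕ.+_) (compile-length e P) ⟩
    size f ℕ.+ (size e ℕ.+ length P)                 ≡⟨ sym (ℕₚ.+-assoc (size f) (size e) (length P)) ⟩
    size f ℕ.+ size e ℕ.+ length P ∎
    where open ≡-Reasoning

  squarings : ℕ → (P : Program) → Compiled P
  squarings zero    P = compiled (op (plus 0 0) ∷ P) (length P) (plus 0 0 ◅ᶜ εᶜ)
  squarings (suc t) P = compiled (op (times (out C) (out C)) ∷ code C) (length (code C)) (times (out C) (out C) ◅ᶜ extends C)
    where
    C : Compiled P
    C = squarings t P

  squarings-correct : ∀ {σ} → σ 0 ≡ + 1 → ∀ t P → All (Holds σ) (constraints (code (squarings t P))) →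
                      σ (out (squarings t P)) ≡ + tower 2 t
  squarings-correct x₀≡1 zero    P (x₀+x₀≡x ∷ _)  = trans (sym x₀+x₀≡x) (cong₂ _+_ x₀≡1 x₀≡1)
  squarings-correct {σ} x₀≡1 (suc t) P (x*x≡x′ ∷ sat) =
    trans (sym x*x≡x′) (trans (cong₂ _*_ x≡ x≡) (sym (ℤₚ.pos-* (tower 2 t) (tower 2 t))))
    where
    x≡ : σ (out (squarings t P)) ≡ + tower 2 t
    x≡ = squarings-correct x₀≡1 t P sat

  squarings-wf : ∀ t P → 0 < length P → WellFormed P → WellCompiled (squarings t P)
  squarings-wf zero    P 0<p wf = ((0<p , 0<p) , wf) , ℕₚ.n<1+n _
  squarings-wf (suc t) P 0<p wf with squarings-wf t P 0<p wf
  ... | wfC , out<C = ((out<C , out<C) , wfC) , ℕₚ.n<1+n _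

  squarings-length : ∀ t P → length (code (squarings t P)) ≡ suc t ℕ.+ length P
  squarings-length zero    P = refl
  squarings-length (suc t) P = cong suc (squarings-length t P)

  padding : ℕ → Program → Program
  padding zero    P = P
  padding (suc t) P = op unit ∷ padding t P

  padding-⊒ᶜ : ∀ t P → padding t P ⊒ᶜ P
  padding-⊒ᶜ zero    P = εᶜ
  padding-⊒ᶜ (suc t) P = unit ◅ᶜ padding-⊒ᶜ t P

  padding-wf : ∀ t P → WellFormed P → WellFormed (padding t P)
  padding-wf zero    P wf = wf
  padding-wf (suc t) P wf = tt , padding-wf t P wf

  padding-length : ∀ t P → length (padding t P) ≡ t ℕ.+ length P
  padding-length zero    P = refl
  padding-length (suc t) P = cong suc (padding-length t P)

  tower-2-≥ : ∀ t → 2 ℕ.* t ℕ.+ 2 ≤ tower 2 t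
  tower-2-≥ zero    = ℕₚ.≤-refl
  tower-2-≥ (suc t) = begin
    2 ℕ.* suc t ℕ.+ 2          ≡⟨ shift t ⟩
    (2 ℕ.* t ℕ.+ 2) ℕ.+ 2       ≤⟨ ℕₚ.+-mono-≤ (tower-2-≥ t) 2≤T ⟩
    T ℕ.+ T                    ≡⟨ double T ⟩
    T ℕ.* 2                    ≤⟨ ℕₚ.*-monoʳ-≤ T 2≤T ⟩
    T ℕ.* T ∎
    where
    open ℕₚ.≤-Reasoning
    T : ℕ
    T = tower 2 t
    2≤T : 2 ≤ T
    2≤T = ℕₚ.≤-trans (ℕₚ.m≤n+m 2 (2 ℕ.* t)) (tower-2-≥ t)
    shift : ∀ t → 2 ℕ.* suc t ℕ.+ 2 ≡ (2 ℕ.* t ℕ.+ 2) ℕ.+ 2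
    shift = ℕ-Solver.solve-∀
    double : ∀ x → x ℕ.+ x ≡ x ℕ.* 2
    double = ℕ-Solver.solve-∀

module Construction where
  open FourSquareTheorem using (sq₄; sq₄-abs; sq₄-cong; FourSquares; lagrange)
  open SmallestBound using (f-exists; f-unique)
  open StraightLinePrograms
  open import Data.Nat as ℕ using (ℕ; zero; suc; z≤n; s≤s; _≤_; _<_; _∸_)
  import Data.Nat.Properties as ℕₚ
  import Data.Nat.Tactic.RingSolver as ℕ-Solver
  open import Data.Integer using (ℤ; +_; -[1+_]; ∣_∣; _+_; _*_)
  import Data.Integer.Properties as ℤₚ
  open import Data.Fin as Fin using (Fin; toℕ; fromℕ<)
  import Data.Fin.Properties as Finₚ
  open import Data.Vec as Vec using (Vec; []; _∷_; lookup)
  import Data.Vec.Properties as Vecₚ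
  open import Data.Vec.Relation.Unary.All using ([]; _∷_)
  import Data.Vec.Relation.Unary.All.Properties as VecAllₚ
  open import Data.List as List using (List; []; _∷_; _++_; length; upTo; cartesianProductWith)
  open import Data.List.Relation.Unary.All as All using (All; []; _∷_)
  open import Data.List.Relation.Unary.Any using (here; there)
  open import Data.List.Membership.Propositional using (_∈_)
  open import Data.List.Membership.Propositional.Properties
    using (∈-++⁺ˡ; ∈-++⁺ʳ; ∈-map⁺; ∈-upTo⁺; ∈-cartesianProductWith⁺)
  open import Data.Product using (Σ; _×_; _,_; proj₁; proj₂)
  open import Data.Unit using (tt)
  open import Data.Empty using (⊥-elim)
  open import Relation.Nullary using (¬_; yes; no)
  open import Relation.Binary.PropositionalEquality

  integersUpTo : ℕ → List ℤ
  integersUpTo B = List.map +_ (upTo (suc B)) ++ List.map -[1+_] (upTo B)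

  ∈-integersUpTo : ∀ {B} z → ∣ z ∣ ≤ B → z ∈ integersUpTo B
  ∈-integersUpTo {B} (+ k)    k≤B   = ∈-++⁺ˡ (∈-map⁺ +_ (∈-upTo⁺ (s≤s k≤B)))
  ∈-integersUpTo {B} -[1+ k ] 1+k≤B = ∈-++⁺ʳ (List.map +_ (upTo (suc B))) (∈-map⁺ -[1+_] (∈-upTo⁺ 1+k≤B))

  box : ℕ → ∀ n → List (Vec ℤ n)
  box B zero    = [] ∷ []
  box B (suc n) = cartesianProductWith _∷_ (integersUpTo B) (box B n)

  ∈-box : ∀ {B n} {x : Vec ℤ n} → InBox B x → x ∈ box B n
  ∈-box []              = here refl
  ∈-box (z≤B ∷ x∈box) = ∈-cartesianProductWith⁺ _∷_ (∈-integersUpTo _ z≤B) (∈-box x∈box)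

  -- Variables of a program are addressed in E_n through toFin, the identity below n.
  module Translation {n : ℕ} (0<n : 0 < n) where
    toFin : ℕ → Fin n
    toFin k with k ℕ.<? n
    ... | yes k<n = fromℕ< k<n
    ... | no  _   = fromℕ< 0<n

    toFin-toℕ : ∀ (i : Fin n) → toFin (toℕ i) ≡ i
    toFin-toℕ i with toℕ i ℕ.<? n
    ... | yes i<n = Finₚ.fromℕ<-toℕ i i<n
    ... | no  i≮n = ⊥-elim (i≮n (Finₚ.toℕ<n i))

    toℕ-toFin : ∀ k → k < n → toℕ (toFin k) ≡ k
    toℕ-toFin k k<n with k ℕ.<? n
    ... | yes k<n′ = Finₚ.toℕ-fromℕ< k<n′
    ... | no  k≮n  = ⊥-elim (k≮n k<n)

    translate : Constraint → Equation n
    translate (is-one i)      = one (toFin i)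
    translate (is-sum i j k)  = add (toFin i) (toFin j) (toFin k)
    translate (is-prod i j k) = mul (toFin i) (toFin j) (toFin k)

    valuation : Vec ℤ n → Valuation
    valuation x k = lookup x (toFin k)

    translate-sound : ∀ x cs → All (Sat x) (List.map translate cs) → All (Holds (valuation x)) cs
    translate-sound x []                  _        = []
    translate-sound x (is-one _ ∷ cs)     (s ∷ ss) = s ∷ translate-sound x cs ss
    translate-sound x (is-sum _ _ _ ∷ cs)  (s ∷ ss) = s ∷ translate-sound x cs ss
    translate-sound x (is-prod _ _ _ ∷ cs) (s ∷ ss) = s ∷ translate-sound x cs ss

    translate-complete : ∀ x cs → All (Holds (valuation x)) cs → All (Sat x) (List.map translate cs)
    translate-complete x []                  _        = []
    translate-complete x (is-one _ ∷ cs)     (s ∷ ss) = s ∷ translate-complete x cs ss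
    translate-complete x (is-sum _ _ _ ∷ cs)  (s ∷ ss) = s ∷ translate-complete x cs ss
    translate-complete x (is-prod _ _ _ ∷ cs) (s ∷ ss) = s ∷ translate-complete x cs ss

  instantiate : ∀ {m} → Poly m → (Fin m → Expr) → Expr
  instantiate (var i)   ι = ι i
  instantiate (const c) ι = lit c
  instantiate (p ⊕ q)   ι = instantiate p ι ⊞ instantiate q ι
  instantiate (p ⊗ q)   ι = instantiate p ι ⊠ instantiate q ι

  instantiate-eval : ∀ {m} (W : Poly m) ι σ (u : Vec ℕ m) → (∀ i → evalExpr σ (ι i) ≡ + lookup u i) →
                     evalExpr σ (instantiate W ι) ≡ eval W u
  instantiate-eval (var i)   ι σ u ι≡u = ι≡u i
  instantiate-eval (const c) ι σ u ι≡u = refl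
  instantiate-eval (p ⊕ q)   ι σ u ι≡u = cong₂ _+_ (instantiate-eval p ι σ u ι≡u) (instantiate-eval q ι σ u ι≡u)
  instantiate-eval (p ⊗ q)   ι σ u ι≡u = cong₂ _*_ (instantiate-eval p ι σ u ι≡u) (instantiate-eval q ι σ u ι≡u)

  instantiate-size : ∀ {m} (W : Poly m) ι ι′ → (∀ i → size (ι i) ≡ size (ι′ i)) →
                     size (instantiate W ι) ≡ size (instantiate W ι′)
  instantiate-size (var i)   ι ι′ same = same i
  instantiate-size (const c) ι ι′ same = refl
  instantiate-size (p ⊕ q)   ι ι′ same = cong suc (cong₂ ℕ._+_ (instantiate-size q ι ι′ same) (instantiate-size p ι ι′ same))
  instantiate-size (p ⊗ q)   ι ι′ same = cong suc (cong₂ ℕ._+_ (instantiate-size q ι ι′ same) (instantiate-size p ι ι′ same))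

  instantiate-refs : ∀ {m} (W : Poly m) ι n → (∀ i → RefsBelow n (ι i)) → RefsBelow n (instantiate W ι)
  instantiate-refs (var i)   ι n refs = refs i
  instantiate-refs (const c) ι n refs = tt
  instantiate-refs (p ⊕ q)   ι n refs = instantiate-refs p ι n refs , instantiate-refs q ι n refs
  instantiate-refs (p ⊗ q)   ι n refs = instantiate-refs p ι n refs , instantiate-refs q ι n refs

  -- Natural numbers enter the system as sums of four squares of input variables,
  -- which forces them to be non-negative (and Lagrange makes every value reachable).
  Quad : Set
  Quad = ℤ × ℤ × ℤ × ℤ

  sumOfSquares : Quad → ℤ
  sumOfSquares (a , b , c , d) = sq₄ a b c d

  squaresAt : ℕ → Expr
  squaresAt i = ref i ⊠ ref i ⊞ ref (1 ℕ.+ i) ⊠ ref (1 ℕ.+ i) ⊞ ref (2 ℕ.+ i) ⊠ ref (2 ℕ.+ i) ⊞ ref (3 ℕ.+ i) ⊠ ref (3 ℕ.+ i)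

  squaresAt-abs : ∀ σ i → evalExpr σ (squaresAt i) ≡ + ∣ evalExpr σ (squaresAt i) ∣
  squaresAt-abs σ i = trans (sq₄-abs a b c d) (cong (λ t → + ∣ t ∣) (sym (sq₄-abs a b c d)))
    where
    a b c d : ℤ
    a = σ i
    b = σ (1 ℕ.+ i)
    c = σ (2 ℕ.+ i)
    d = σ (3 ℕ.+ i)

  entries-≤ : ∀ {c} a b c′ d → ∣ sq₄ a b c′ d ∣ ≤ c → ∣ a ∣ ≤ c × ∣ b ∣ ≤ c × ∣ c′ ∣ ≤ c × ∣ d ∣ ≤ c
  entries-≤ {c} a b c′ d sum≤c rewrite sq₄-abs a b c′ d =
    ≤c (≤-square ∣ a ∣) (ℕₚ.≤-trans (ℕₚ.m≤m+n A B) (ℕₚ.≤-trans (ℕₚ.m≤m+n (A ℕ.+ B) C) (ℕₚ.m≤m+n (A ℕ.+ B ℕ.+ C) D))) ,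
    ≤c (≤-square ∣ b ∣) (ℕₚ.≤-trans (ℕₚ.m≤n+m B A) (ℕₚ.≤-trans (ℕₚ.m≤m+n (A ℕ.+ B) C) (ℕₚ.m≤m+n (A ℕ.+ B ℕ.+ C) D))) ,
    ≤c (≤-square ∣ c′ ∣) (ℕₚ.≤-trans (ℕₚ.m≤n+m C (A ℕ.+ B)) (ℕₚ.m≤m+n (A ℕ.+ B ℕ.+ C) D)) ,
    ≤c (≤-square ∣ d ∣) (ℕₚ.m≤n+m D (A ℕ.+ B ℕ.+ C))
    where
    A B C D : ℕ
    A = ∣ a ∣ ℕ.* ∣ a ∣
    B = ∣ b ∣ ℕ.* ∣ b ∣
    C = ∣ c′ ∣ ℕ.* ∣ c′ ∣
    D = ∣ d ∣ ℕ.* ∣ d ∣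
    ≤-square : ∀ u → u ≤ u ℕ.* u
    ≤-square zero    = z≤n
    ≤-square (suc u) = ℕₚ.m≤m*n (suc u) (suc u)
    ≤c : ∀ {u w} → u ≤ w → w ≤ A ℕ.+ B ℕ.+ C ℕ.+ D → u ≤ c
    ≤c u≤w w≤sum = ℕₚ.≤-trans u≤w (ℕₚ.≤-trans w≤sum sum≤c)

  quadInputs : Quad → Program → Program
  quadInputs (a , b , c , d) P = input d ∷ input c ∷ input b ∷ input a ∷ P

  inputsFor : ∀ {m} → Vec Quad m → Program → Program × Vec ℕ m
  inputsFor []       P = P , []
  inputsFor {suc m} (q ∷ qs) P = proj₁ rest , length P ∷ proj₂ rest
    where
    rest : Program × Vec ℕ m
    rest = inputsFor qs (quadInputs q P)

  inputs-⊒ : ∀ {m} (qs : Vec Quad m) P → proj₁ (inputsFor qs P) ⊒ P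
  inputs-⊒ []       P = ε
  inputs-⊒ (q ∷ qs) P = ⊒-trans (inputs-⊒ qs (quadInputs q P)) (_ ◅ _ ◅ _ ◅ _ ◅ ε)

  inputs-wf : ∀ {m} (qs : Vec Quad m) P → WellFormed P → WellFormed (proj₁ (inputsFor qs P))
  inputs-wf []       P wf = wf
  inputs-wf (q ∷ qs) P wf = inputs-wf qs (quadInputs q P) wf

  inputs-length : ∀ {m} (qs : Vec Quad m) P → length (proj₁ (inputsFor qs P)) ≡ m ℕ.* 4 ℕ.+ length P
  inputs-length []           P = refl
  inputs-length {suc m} (q ∷ qs) P = trans (inputs-length qs (quadInputs q P)) (shift m (length P))
    where
    shift : ∀ m L → m ℕ.* 4 ℕ.+ suc (suc (suc (suc L))) ≡ suc m ℕ.* 4 ℕ.+ L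
    shift = ℕ-Solver.solve-∀

  squaresAt-refs : ∀ {n} i → 3 ℕ.+ i < n → RefsBelow n (squaresAt i)
  squaresAt-refs {n} i 3+i<n = (((i<n , i<n) , (1+i<n , 1+i<n)) , (2+i<n , 2+i<n)) , (3+i<n , 3+i<n)
    where
    2+i<n : 2 ℕ.+ i < n
    1+i<n : 1 ℕ.+ i < n
    i<n   : i < n
    2+i<n = ℕₚ.<-trans (ℕₚ.n<1+n _) 3+i<n
    1+i<n = ℕₚ.<-trans (ℕₚ.n<1+n _) 2+i<n
    i<n   = ℕₚ.<-trans (ℕₚ.n<1+n _) 1+i<n

  inputs-refs : ∀ {m} (qs : Vec Quad m) P {n} → length (proj₁ (inputsFor qs P)) ≤ n →
                ∀ t → RefsBelow n (squaresAt (lookup (proj₂ (inputsFor qs P)) t))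
  inputs-refs (q ∷ qs) P ≤n Fin.zero    = squaresAt-refs (length P) (ℕₚ.≤-trans (⊒-length (inputs-⊒ qs (quadInputs q P))) ≤n)
  inputs-refs (q ∷ qs) P ≤n (Fin.suc t) = inputs-refs qs (quadInputs q P) ≤n t

  run-input : ∀ {z P P′} → P′ ⊒ input z ∷ P → run P′ (length P) ≡ z
  run-input {z} {P} ext = trans (sym (⊒-run ext (length P) (ℕₚ.n<1+n _))) (update-here (run P) (length P) z)

  inputs-run : ∀ {m} (qs : Vec Quad m) P {P′} → P′ ⊒ proj₁ (inputsFor qs P) →
               ∀ t → evalExpr (run P′) (squaresAt (lookup (proj₂ (inputsFor qs P)) t)) ≡ sumOfSquares (lookup qs t)
  inputs-run ((a , b , c , d) ∷ qs) P {P′} ext Fin.zero =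
    sq₄-cong (run-input (⊒-trans ext′ (_ ◅ _ ◅ _ ◅ ε))) (run-input (⊒-trans ext′ (_ ◅ _ ◅ ε)))
             (run-input (⊒-trans ext′ (_ ◅ ε))) (run-input ext′)
    where
    ext′ : P′ ⊒ quadInputs (a , b , c , d) P
    ext′ = ⊒-trans ext (inputs-⊒ qs (quadInputs (a , b , c , d) P))
  inputs-run (q ∷ qs) P ext (Fin.suc t) = inputs-run qs (quadInputs q P) ext t

  inputs-bounded : ∀ {m} (qs : Vec Quad m) P {c σ} → InputsBounded c σ P →
                   (∀ t → ∣ evalExpr σ (squaresAt (lookup (proj₂ (inputsFor qs P)) t)) ∣ ≤ c) →
                   InputsBounded c σ (proj₁ (inputsFor qs P))
  inputs-bounded []       P bounded _      = bounded
  inputs-bounded (q ∷ qs) P {c} {σ} bounded sums≤c =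
    inputs-bounded qs (quadInputs q P) (first (entries-≤ (σ L) (σ (1 ℕ.+ L)) (σ (2 ℕ.+ L)) (σ (3 ℕ.+ L)) (sums≤c Fin.zero)))
                   (λ t → sums≤c (Fin.suc t))
    where
    L : ℕ
    L = length P
    first : ∣ σ L ∣ ≤ c × ∣ σ (1 ℕ.+ L) ∣ ≤ c × ∣ σ (2 ℕ.+ L) ∣ ≤ c × ∣ σ (3 ℕ.+ L) ∣ ≤ c →
            InputsBounded c σ (quadInputs q P)
    first (a≤ , b≤ , c≤ , d≤) = d≤ , c≤ , b≤ , a≤ , bounded

  lookup≤sum : ∀ {m} (xs : Vec ℕ m) i → lookup xs i ≤ Vec.sum xs
  lookup≤sum (x ∷ xs) Fin.zero    = ℕₚ.m≤m+n x (Vec.sum xs)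
  lookup≤sum (x ∷ xs) (Fin.suc i) = ℕₚ.≤-trans (lookup≤sum xs i) (ℕₚ.m≤n+m (Vec.sum xs) x)

  totalSum : ∀ {m} → List (Vec ℕ m) → ℕ
  totalSum []       = 0
  totalSum (x ∷ xs) = Vec.sum x ℕ.+ totalSum xs

  sum≤totalSum : ∀ {m} (xs : List (Vec ℕ m)) {x} → x ∈ xs → Vec.sum x ≤ totalSum xs
  sum≤totalSum (x ∷ xs) (here refl) = ℕₚ.m≤m+n (Vec.sum x) (totalSum xs)
  sum≤totalSum (y ∷ xs) (there x∈)  = ℕₚ.≤-trans (sum≤totalSum xs x∈) (ℕₚ.m≤n+m (totalSum xs) (Vec.sum y))

  quadOf : ℕ → Quad
  quadOf x = FourSquares.a s , FourSquares.b s , FourSquares.c s , FourSquares.d s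
    where
    s : FourSquares (+ x)
    s = lagrange x

  quadOf-sum : ∀ x → sumOfSquares (quadOf x) ≡ + x
  quadOf-sum x = sym (FourSquares.eq (lagrange x))

  -- Its variables are:
  -- x₀ = 1; four inputs per value, whose sums of squares encode v, r₁, …, r_k; the
  -- squaring chain computing n = tower 2 D; the compiled value o = W(n, v, r) with
  -- o + o = o; the value v + 1; and padding up to n variables. Only the inputs
  -- depend on v and r, so the length of the program does not.
  module Encoding {k : ℕ} (W : Poly (suc (suc k))) where
    -- Substituting template expressions has the same size as the real substitution.
    template : Fin (suc (suc k)) → Expr
    template Fin.zero    = ref 0
    template (Fin.suc _) = squaresAt 0

    -- The number of instructions other than the squaring chain: x₀, 4(k + 1) inputs,
    -- the instance of W, and 10 for v + 1.
    D : ℕ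
    D = 10 ℕ.+ size (instantiate W template) ℕ.+ (suc k ℕ.* 4 ℕ.+ 1)

    n : ℕ
    n = tower 2 D

    2D+1<n : D ℕ.+ suc D < n
    2D+1<n = ℕₚ.<-≤-trans (ℕₚ.≤-reflexive (double D)) (tower-2-≥ D)
      where
      double : ∀ d → suc (d ℕ.+ suc d) ≡ 2 ℕ.* d ℕ.+ 2
      double = ℕ-Solver.solve-∀

    0<n : 0 < n
    0<n = ℕₚ.≤-<-trans z≤n 2D+1<n

    open Translation 0<n public

    module Built (v : ℕ) (r : Vec ℕ k) where
      P₀ : Program
      P₀ = op unit ∷ []

      quads : Vec Quad (suc k)
      quads = Vec.map quadOf (v ∷ r)

      P₁ : Program
      P₁ = proj₁ (inputsFor quads P₀)

      bases : Vec ℕ (suc k)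
      bases = proj₂ (inputsFor quads P₀)

      N : Compiled P₁
      N = squarings D P₁

      arguments : Fin (suc (suc k)) → Expr
      arguments Fin.zero    = ref (out N)
      arguments (Fin.suc t) = squaresAt (lookup bases t)

      E : Compiled (code N)
      E = compile (instantiate W arguments) (code N)

      V : Compiled (code E)
      V = compile (squaresAt (lookup bases Fin.zero) ⊞ lit (+ 1)) (code E)

      program : Program
      program = padding (n ∸ length (code V)) (code V)

      system : System n
      system = List.map translate (is-sum (out E) (out E) (out E) ∷ constraints program)

      length-V : length (code V) ≡ D ℕ.+ suc D
      length-V = begin
        length (code V)                                          ≡⟨ compile-length (squaresAt (lookup bases Fin.zero) ⊞ lit (+ 1)) (code E) ⟩
        10 ℕ.+ length (code E)                                   ≡⟨ cong (10 ℕ.+_) (compile-length (instantiate W arguments) (code N)) ⟩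
        10 ℕ.+ (size (instantiate W arguments) ℕ.+ length (code N))
          ≡⟨ cong (λ s → 10 ℕ.+ (s ℕ.+ length (code N))) (instantiate-size W arguments template same-size) ⟩
        10 ℕ.+ (size (instantiate W template) ℕ.+ length (code N)) ≡⟨ cong (λ l → 10 ℕ.+ (size (instantiate W template) ℕ.+ l)) (squarings-length D P₁) ⟩
        10 ℕ.+ (size (instantiate W template) ℕ.+ (suc D ℕ.+ length P₁))
          ≡⟨ cong (λ l → 10 ℕ.+ (size (instantiate W template) ℕ.+ (suc D ℕ.+ l))) (inputs-length quads P₀) ⟩
        10 ℕ.+ (size (instantiate W template) ℕ.+ (suc D ℕ.+ (suc k ℕ.* 4 ℕ.+ 1))) ≡⟨ regroup (size (instantiate W template)) D (suc k ℕ.* 4) ⟩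
        D ℕ.+ suc D ∎
        where
        open ≡-Reasoning
        same-size : ∀ i → size (arguments i) ≡ size (template i)
        same-size Fin.zero    = refl
        same-size (Fin.suc _) = refl
        regroup : ∀ s d q → 10 ℕ.+ (s ℕ.+ (suc d ℕ.+ (q ℕ.+ 1))) ≡ 10 ℕ.+ s ℕ.+ (q ℕ.+ 1) ℕ.+ suc d
        regroup = ℕ-Solver.solve-∀

      length-V≤n : length (code V) ≤ n
      length-V≤n = ℕₚ.≤-trans (ℕₚ.≤-reflexive length-V) (ℕₚ.<⇒≤ 2D+1<n)

      length-program : length program ≡ n
      length-program = trans (padding-length (n ∸ length (code V)) (code V)) (ℕₚ.m∸n+n≡m length-V≤n)

      N⊒ᶜP₁ : code N ⊒ᶜ P₁
      N⊒ᶜP₁ = extends N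

      program⊒ᶜE : program ⊒ᶜ code E
      program⊒ᶜE = ⊒ᶜ-trans (padding-⊒ᶜ (n ∸ length (code V)) (code V)) (extends V)

      program⊒ᶜN : program ⊒ᶜ code N
      program⊒ᶜN = ⊒ᶜ-trans program⊒ᶜE (extends E)

      program⊒ᶜP₁ : program ⊒ᶜ P₁
      program⊒ᶜP₁ = ⊒ᶜ-trans program⊒ᶜN N⊒ᶜP₁

      program⊒P₀ : program ⊒ P₀
      program⊒P₀ = ⊒-trans (⊒ᶜ⇒⊒ program⊒ᶜP₁) (inputs-⊒ quads P₀)

      0<P₁ : 0 < length P₁
      0<P₁ = ⊒-length (inputs-⊒ quads P₀)

      wellCompiled-N : WellCompiled N
      wellCompiled-N = squarings-wf D P₁ 0<P₁ (inputs-wf quads P₀ (tt , tt))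

      arguments-refs : ∀ i → RefsBelow (length (code N)) (arguments i)
      arguments-refs Fin.zero    = proj₂ wellCompiled-N
      arguments-refs (Fin.suc t) = inputs-refs quads P₀ (compiled-length N) t

      wellCompiled-E : WellCompiled E
      wellCompiled-E = compile-wf (instantiate W arguments) (code N) (ℕₚ.<-≤-trans 0<P₁ (compiled-length N))
        (instantiate-refs W arguments (length (code N)) arguments-refs) (proj₁ wellCompiled-N)

      wellCompiled-V : WellCompiled V
      wellCompiled-V = compile-wf (squaresAt (lookup bases Fin.zero) ⊞ lit (+ 1)) (code E)
        (ℕₚ.<-≤-trans 0<P₁ (ℕₚ.≤-trans (compiled-length N) (compiled-length E)))
        (inputs-refs quads P₀ (ℕₚ.≤-trans (compiled-length N) (compiled-length E)) Fin.zero , tt)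
        (proj₁ wellCompiled-E)

      wellFormed : WellFormed program
      wellFormed = padding-wf (n ∸ length (code V)) (code V) (proj₁ wellCompiled-V)

      o<n : out E < n
      o<n = ℕₚ.<-≤-trans (proj₂ wellCompiled-E) (ℕₚ.≤-trans (compiled-length V) length-V≤n)

      v+1<n : out V < n
      v+1<n = ℕₚ.<-≤-trans (proj₂ wellCompiled-V) length-V≤n

    module Intended (v : ℕ) (r : Vec ℕ k) (W≡0 : eval W (n ∷ v ∷ r) ≡ + 0) where
      open Built v r

      τ : Valuation
      τ = run program

      x : Vec ℤ n
      x = Vec.tabulate (λ i → τ (toℕ i))

      τ≈x : Agree n τ (valuation x)
      τ≈x k k<n = sym (trans (Vecₚ.lookup∘tabulate (λ i → τ (toℕ i)) (toFin k)) (cong τ (toℕ-toFin k k<n)))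

      τ-satisfies : All (Holds τ) (constraints program)
      τ-satisfies = run-satisfies program wellFormed

      τ₀ : τ 0 ≡ + 1
      τ₀ = All.head (⊒-constraints program⊒P₀ τ-satisfies)

      τ-arguments : ∀ i → evalExpr τ (arguments i) ≡ + lookup (n ∷ v ∷ r) i
      τ-arguments Fin.zero    = squarings-correct τ₀ D P₁ (⊒-constraints (⊒ᶜ⇒⊒ program⊒ᶜN) τ-satisfies)
      τ-arguments (Fin.suc t) = begin
        evalExpr τ (squaresAt (lookup bases t))  ≡⟨ inputs-run quads P₀ (⊒ᶜ⇒⊒ program⊒ᶜP₁) t ⟩
        sumOfSquares (lookup quads t)            ≡⟨ cong sumOfSquares (Vecₚ.lookup-map t quadOf (v ∷ r)) ⟩
        sumOfSquares (quadOf (lookup (v ∷ r) t)) ≡⟨ quadOf-sum (lookup (v ∷ r) t) ⟩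
        + lookup (v ∷ r) t ∎
        where open ≡-Reasoning

      τ-o : τ (out E) ≡ + 0
      τ-o = begin
        τ (out E)                                   ≡⟨ compile-correct τ₀ (instantiate W arguments) (code N)
                                                         (⊒-constraints (⊒ᶜ⇒⊒ program⊒ᶜE) τ-satisfies) ⟩
        evalExpr τ (instantiate W arguments)        ≡⟨ instantiate-eval W arguments τ (n ∷ v ∷ r) τ-arguments ⟩
        eval W (n ∷ v ∷ r)                          ≡⟨ W≡0 ⟩
        + 0 ∎
        where open ≡-Reasoning

      τ-v+1 : τ (out V) ≡ + suc v
      τ-v+1 = begin
        τ (out V)                                   ≡⟨ compile-correct τ₀ (squaresAt (lookup bases Fin.zero) ⊞ lit (+ 1)) (code E)
                                                         (⊒-constraints (⊒ᶜ⇒⊒ (padding-⊒ᶜ (n ∸ length (code V)) (code V))) τ-satisfies) ⟩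
        evalExpr τ (squaresAt (lookup bases Fin.zero)) + + 1 ≡⟨ cong (_+ + 1) (τ-arguments (Fin.suc Fin.zero)) ⟩
        + v + + 1                                   ≡⟨ sym (ℤₚ.pos-+ v 1) ⟩
        + (v ℕ.+ 1)                                 ≡⟨ cong +_ (ℕₚ.+-comm v 1) ⟩
        + suc v ∎
        where open ≡-Reasoning

      solution : Solution system x
      solution = translate-complete x (is-sum (out E) (out E) (out E) ∷ constraints program)
        ( holds-agree (is-sum (out E) (out E) (out E)) (o<n , o<n , o<n) τ≈x (trans (cong₂ _+_ τ-o τ-o) (sym τ-o))
        ∷ all-holds-agree (constraints program)
            (subst (λ l → All (Within l) (constraints program)) length-program (constraints-within program wellFormed))
            τ≈x τ-satisfies)

      x-v+1 : ∣ lookup x (toFin (out V)) ∣ ≡ suc v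
      x-v+1 = cong ∣_∣ (trans (sym (τ≈x (out V) v+1<n)) τ-v+1)

    -- If W represents f finite-fold and f(n) = v, every solution of the system lies in
    -- a fixed box: the sums of squares of the inputs are a zero (n, u₀, u′) of W, so
    -- u₀ = f(n) = v and u′ is one of the finitely many r with W(n, v, r) = 0; this
    -- bounds the inputs, and then every variable by solution-bound.
    module Finite (rep : Represents W) (ff : FiniteFold W) (v : ℕ) (r : Vec ℕ k) (fn≡v : FGraph n v) where
      open Built v r

      c : ℕ
      c = v ℕ.+ totalSum (proj₁ (ff n v))

      module _ (y : Vec ℤ n) (sol : Solution system y) where
        σ : Valuation
        σ = valuation y

        σ-satisfies : All (Holds σ) (is-sum (out E) (out E) (out E) ∷ constraints program)
        σ-satisfies = translate-sound y (is-sum (out E) (out E) (out E) ∷ constraints program) sol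

        σ₀ : σ 0 ≡ + 1
        σ₀ = All.head (⊒-constraints program⊒P₀ (All.tail σ-satisfies))

        u : Fin (suc k) → ℕ
        u t = ∣ evalExpr σ (squaresAt (lookup bases t)) ∣

        σ-arguments : ∀ i → evalExpr σ (arguments i) ≡ + lookup (n ∷ Vec.tabulate u) i
        σ-arguments Fin.zero    = squarings-correct {σ} σ₀ D P₁ (⊒-constraints (⊒ᶜ⇒⊒ program⊒ᶜN) (All.tail σ-satisfies))
        σ-arguments (Fin.suc t) = trans (squaresAt-abs σ (lookup bases t)) (cong +_ (sym (Vecₚ.lookup∘tabulate u t)))

        W≡0 : eval W (n ∷ Vec.tabulate u) ≡ + 0
        W≡0 = begin
          eval W (n ∷ Vec.tabulate u)            ≡⟨ sym (instantiate-eval W arguments σ (n ∷ Vec.tabulate u) σ-arguments) ⟩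
          evalExpr σ (instantiate W arguments)   ≡⟨ sym (compile-correct {σ} σ₀ (instantiate W arguments) (code N)
                                                      (⊒-constraints (⊒ᶜ⇒⊒ program⊒ᶜE) (All.tail σ-satisfies))) ⟩
          σ (out E)                              ≡⟨ idempotent (σ (out E)) (All.head σ-satisfies) ⟩
          + 0 ∎
          where
          open ≡-Reasoning
          idempotent : ∀ z → z + z ≡ z → z ≡ + 0
          idempotent z z+z≡z = trans (sum⇒difference {z} {z} {z} z+z≡z) (ℤₚ.+-inverseʳ z)

        rest : Vec ℕ k
        rest = Vec.tabulate (λ t → u (Fin.suc t))

        u₀≡v : u Fin.zero ≡ v
        u₀≡v = f-unique (proj₂ (proj₂ (rep n (u Fin.zero)) (rest , W≡0))) fn≡v

        rest∈ : rest ∈ proj₁ (ff n v)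
        rest∈ = proj₂ (ff n v) rest (subst (λ w → eval W (n ∷ w ∷ rest) ≡ + 0) u₀≡v W≡0)

        u≤c : ∀ t → u t ≤ c
        u≤c Fin.zero    = subst (_≤ c) (sym u₀≡v) (ℕₚ.m≤m+n v _)
        u≤c (Fin.suc t) = ℕₚ.≤-trans (subst (_≤ Vec.sum rest) (Vecₚ.lookup∘tabulate (λ t → u (Fin.suc t)) t) (lookup≤sum rest t))
                            (ℕₚ.≤-trans (sum≤totalSum (proj₁ (ff n v)) rest∈) (ℕₚ.m≤n+m _ v))

        inputs≤c : InputsBounded c σ program
        inputs≤c = ⊒ᶜ-inputsBounded program⊒ᶜP₁ (inputs-bounded quads P₀ tt u≤c)

        inBox : InBox (tower (2 ℕ.+ c) n) y
        inBox = VecAllₚ.lookup⁻ λ i → subst (λ j → ∣ lookup y j ∣ ≤ tower (2 ℕ.+ c) n) (toFin-toℕ i)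
          (ℕₚ.≤-trans (solution-bound c σ program wellFormed (All.tail σ-satisfies) inputs≤c (toℕ i)
                        (subst (toℕ i <_) (sym length-program) (Finₚ.toℕ<n i)))
                      (tower-mono (s≤s z≤n) (ℕₚ.<⇒≤ (Finₚ.toℕ<n i))))

      finite : FinitelyManySolutions system
      finite = box (tower (2 ℕ.+ c) n) n , λ y sol → ∈-box (inBox y sol)

    -- With v = f(n) and a zero r of W(n, v, ·), the system has finitely many
    -- solutions, so they all lie in [−v, v]ⁿ by definition of f(n); yet the intended
    -- solution has an entry v + 1.
    no-zero : Represents W → FiniteFold W → ∀ v → FGraph n v → ¬ Σ (Vec ℕ k) (λ r → eval W (n ∷ v ∷ r) ≡ + 0)
    no-zero rep ff v fn≡v (r , W≡0) = ℕₚ.<-irrefl refl (subst (_≤ v) x-v+1 (VecAllₚ.lookup⁺ x∈box (toFin (out V))))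
      where
      open Built v r
      open Intended v r W≡0
      x∈box : InBox v x
      x∈box = proj₁ fn≡v system (Finite.finite rep ff v r fn≡v) x solution

open SmallestBound using (f-exists)
open Construction using (module Encoding)

theorem2 : ¬ (Σ ℕ λ k → Σ (Poly (suc (suc k))) λ W → Represents W × FiniteFold W)
theorem2 (k , W , rep , ff) = f-exists n λ (v , fn≡v) → no-zero rep ff v fn≡v (proj₁ (rep n v) (0<n , fn≡v))
  where open Encoding W
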